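{- Let $n\ge1$, $t\ge1$, and suppose the cycle $C_r$ is $t$-embedded in the cycle $C_m$. Write $\mathrm{key}(C_r)=uv$ where $u$ is the shortest prefix of $\mathrm{key}(C_r)$ containing $t$ non-zero symbols. Then $\mathrm{key}(C_m)=0^{|u|}v$.
   Context: Words are over $\mathbb N$; $\sigma^t$ denotes $t$ repetitions of $\sigma$, $|u|$ is the length. A rotation of $xy$ is $yx$. For words of equal length, $w_1\le_{\mathrm{colex}} w_2$ means the reversal of $w_1$ is lexicographically $\le$ the reversal of $w_2$. A key-word is a length-$n$ word colex-maximal among its rotations. For $k\ge1$ let $c(n,k)$ be the number of key-words in $[k]^n$ ($[k]=\{0,\dots,k-1\}$), listed in increasing colex order $\mathrm{key}_0<\cdots<\mathrm{key}_{c(n,k)-1}$ (consistently in $k$). Cycles: $C_0=(0^n)$, $\mathrm{key}(C_0)=\mathrm{first}(C_0)=\mathrm{last}(C_0)=0^n$. For $m\ge1$ write $\mathrm{key}_m=0^l(\sigma+1)w$; $C_m$ is the sequence of all distinct rotations of $\mathrm{key}_m$, starting with $\mathrm{first}(C_m)=w0^l(\sigma+1)$, in which each word $\tau w'$ is followed by $w'\tau$, ending with $\mathrm{last}(C_m)=(\sigma+1)w0^l$; $\mathrm{key}(C_m)=\mathrm{key}_m$. Construction: $D_0=(0^n)$; writing $\mathrm{key}_{m+1}=0^l(\sigma+1)w$, $D_{m+1}$ is obtained from $D_m$ by inserting the sequence $C_{m+1}$ immediately after the word $\sigma w0^l$ of $D_m$. $D(n,k)=D_{c(n,k)-1}$.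 For length-$n$ words $u,v$, $u<v$ means $u$ appears before $v$ in $D(n,k)$ for some (equivalently any) $k$ with $u,v\in[k]^n$. $C_r$ is embedded in $C_m$ if $\mathrm{first}(C_m)<\mathrm{first}(C_r)\le\mathrm{last}(C_r)<\mathrm{last}(C_m)$; immediately embedded if moreover no cycle $C_l$ has $C_r$ embedded in $C_l$ and $C_l$ embedded in $C_m$. $C_r$ is $1$-embedded in $C_m$ if immediately embedded; $C_r$ is $(t+1)$-embedded in $C_m$ if there is a cycle $C_l$ with $C_r$ $t$-embedded in $C_l$ and $C_l$ $1$-embedded in $C_m$. -}

module Defs where

open import Data.Nat using (ℕ; zero; suc; _<_; _≤_; _<ᵇ_; _≡ᵇ_; _≟_)
open import Data.Bool using (Bool; true; false; if_then_else_; _∧_)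
open import Data.List using (List; []; _∷_; _++_; [_]; length; reverse; drop; take;
  replicate; concatMap; map; upTo; foldr; iterate; filterᵇ)
open import Data.List.Properties using (≡-dec)
open import Data.Bool.ListAction using (and)
open import Data.Maybe using (Maybe; just; nothing)
open import Data.Product using (_×_; _,_; ∃; ∃-syntax)
open import Data.Sum using (_⊎_)
open import Relation.Nullary using (¬_; does)
open import Relation.Binary.PropositionalEquality using (_≡_)

Word : Set
Word = List ℕ

_==ʷ_ : Word → Word → Bool
u ==ʷ v = does (≡-dec _≟_ u v)

allWords : ℕ → ℕ → List Word
allWords zero    k = [ [] ]
allWords (suc n) k = concatMap (λ a → map (a ∷_) (allWords n k)) (upTo k)

-- lexicographic ≤ (used on words of equal length)
lexLeq : Word → Word → Bool
lexLeq []       _        = true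
lexLeq (x ∷ xs) []       = false
lexLeq (x ∷ xs) (y ∷ ys) =
  if x <ᵇ y then true else (if x ≡ᵇ y then lexLeq xs ys else false)

colexLeq : Word → Word → Bool
colexLeq u v = lexLeq (reverse u) (reverse v)

rot : ℕ → Word → Word
rot i w = drop i w ++ take i w

isKey : Word → Bool
isKey w = and (map (λ i → colexLeq (rot i w) w) (upTo (length w)))

insertColex : Word → List Word → List Word
insertColex w []       = [ w ]
insertColex w (x ∷ xs) = if colexLeq w x then w ∷ x ∷ xs else x ∷ insertColex w xs

sortColex : List Word → List Word
sortColex = foldr insertColex []

-- key-words of [k]^n in increasing colex order: key_0 < key_1 < ...
keyList : ℕ → ℕ → List Word
keyList n k = sortColex (filterᵇ isKey (allWords n k))

c : ℕ → ℕ → ℕ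
c n k = length (keyList n k)

nth : {A : Set} → List A → ℕ → Maybe A
nth []       _       = nothing
nth (x ∷ xs) zero    = just x
nth (x ∷ xs) (suc i) = nth xs i

nthD : Word → List Word → ℕ → Word
nthD d []       _       = d
nthD d (x ∷ xs) zero    = x
nthD d (x ∷ xs) (suc i) = nthD d xs i

-- key_m (meaningful for m < c n k)
key : ℕ → ℕ → ℕ → Word
key n k m = nthD (replicate n 0) (keyList n k) m

-- decomposition of a non-zero word  0^l (σ+1) w  as (l , σ , w)
record Decomp : Set where
  constructor dec
  field
    l : ℕ
    σ : ℕ
    w : Word

decomp : Word → Decomp
decomp []          = dec 0 0 []
decomp (zero ∷ xs) with decomp xs
... | dec l s w = dec (suc l) s w
decomp (suc s ∷ xs) = dec 0 s xs

rot1 : Word → Word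
rot1 []       = []
rot1 (x ∷ xs) = xs ++ [ x ]

-- number of distinct rotations of w (least period p ≥ 1 with rot p w = w)
periodAux : ℕ → ℕ → Word → ℕ
periodAux zero    i w = i
periodAux (suc f) i w = if rot i w ==ʷ w then i else periodAux f (suc i) w

period : Word → ℕ
period w = periodAux (length w) 1 w

firstOfKey : Word → Word
firstOfKey kw with decomp kw
... | dec l s w = w ++ replicate l 0 ++ [ suc s ]

lastOfKey : Word → Word
lastOfKey kw with decomp kw
... | dec l s w = suc s ∷ w ++ replicate l 0

-- the word σ w 0^l after which C_m is inserted
anchorOfKey : Word → Word
anchorOfKey kw with decomp kw
... | dec l s w = s ∷ w ++ replicate l 0

first : ℕ → ℕ → ℕ → Word
first n k zero    = replicate n 0
first n k (suc m) = firstOfKey (key n k (suc m))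

last : ℕ → ℕ → ℕ → Word
last n k zero    = replicate n 0
last n k (suc m) = lastOfKey (key n k (suc m))

cycle : ℕ → ℕ → ℕ → List Word
cycle n k zero    = [ replicate n 0 ]
cycle n k (suc m) = iterate rot1 (first n k (suc m)) (period (key n k (suc m)))

insertAfter : Word → List Word → List Word → List Word
insertAfter a cs []       = []
insertAfter a cs (x ∷ xs) = if x ==ʷ a then x ∷ cs ++ xs else x ∷ insertAfter a cs xs

Dm : ℕ → ℕ → ℕ → List Word
Dm n k zero    = [ replicate n 0 ]
Dm n k (suc m) = insertAfter (anchorOfKey (key n k (suc m))) (cycle n k (suc m)) (Dm n k m)

D : ℕ → ℕ → List Word
D n k = Dm n k (c n k Data.Nat.∸ 1)

Before : ℕ → ℕ → Word → Word → Set
Before n k u v = ∃[ i ] ∃[ j ] (i < j × nth (D n k) i ≡ just u × nth (D n k) j ≡ just v)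

BeforeEq : ℕ → ℕ → Word → Word → Set
BeforeEq n k u v = u ≡ v ⊎ Before n k u v

Embedded : ℕ → ℕ → ℕ → ℕ → Set
Embedded n k r m =
  Before n k (first n k m) (first n k r) ×
  BeforeEq n k (first n k r) (last n k r) ×
  Before n k (last n k r) (last n k m)

ImmEmbedded : ℕ → ℕ → ℕ → ℕ → Set
ImmEmbedded n k r m =
  Embedded n k r m ×
  ¬ (∃[ l ] (l < c n k × Embedded n k r l × Embedded n k l m))

data TEmbedded (n k : ℕ) : ℕ → ℕ → ℕ → Set where
  one  : ∀ {r m} → ImmEmbedded n k r m → TEmbedded n k 1 r m
  step : ∀ {t r l m} → l < c n k → TEmbedded n k t r l → ImmEmbedded n k l m →
         TEmbedded n k (suc t) r m

nz : Word → ℕ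
nz []          = 0
nz (zero ∷ xs) = nz xs
nz (suc _ ∷ xs) = suc (nz xs)

ShortestNZPrefix : ℕ → Word → Word → Word → Set
ShortestNZPrefix t w u v =
  w ≡ u ++ v × nz u ≡ t × (∀ j → nz (take j w) ≡ t → length u ≤ j)

{-# OPTIONS --safe #-}

-- The words of a cycle C m and of the cycles later inserted among them always form a contiguous
-- block of D j running from first(C m) to last(C m): a later cycle lands inside this block exactly
-- when its anchor is a word of the block other than last(C m). Hence C r is embedded in C m iff
-- C r descends from C m in this insertion tree.
-- If C r, with key 0ˡ (σ+1) w, is immediately embedded in C m, its anchor σ w 0ˡ lies either in
-- C m itself, where it cannot be last(C m), forcing σ = 0, or it is last(C p) for a cycle C p
-- immediately embedded in C m. Since lowering the first non-zero letter of a key-word yields a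
-- key-word and conjugate key-words coincide, in both cases key(C m) = 0ˡ 0 w. So every level of
-- embedding zeroes the first remaining non-zero letter of key(C r).

module Submission where

open import Defs
open import Data.Bool using (true; false; T)
open import Data.Bool.Properties using (T?; T-≡)
open import Data.Empty using (⊥; ⊥-elim)
open import Data.List
  using (List; []; _∷_; _++_; [_]; length; replicate; reverse; drop; take; upTo; map; iterate; applyUpTo; filterᵇ)
open import Data.List.Properties
  using (++-assoc; ++-identityʳ; reverse-++; reverse-involutive; reverse-injective; unfold-reverse;
         length-++; length-++-comm; length-take; length-reverse; length-replicate; take-all; drop-all;
         take++drop≡id; ∷-injective; ∷-injectiveˡ; ∷-injectiveʳ; ∷ʳ-injective; ≡-dec; applyUpTo-∷ʳ)
open import Data.List.Membership.Propositional using (_∈_; _∉_)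
open import Data.List.Membership.Propositional.Properties
  using (∈-upTo⁺; ∈-applyUpTo⁻; ∈-++⁺ˡ; ∈-++⁺ʳ; ∈-++⁻; ∈-filter⁻; ∈-filter⁺; ∈-map⁺;
         ∈-concatMap⁺; ∈-concatMap⁻; map∷⁻; map∷-decomp∈)
open import Data.List.Relation.Binary.Disjoint.Propositional using (Disjoint)
open import Data.List.Relation.Binary.Permutation.Propositional
  using (_↭_; ↭-refl; ↭-prep; ↭-swap; ↭-trans; ↭-sym; ↭⇒↭ₛ)
open import Data.List.Relation.Binary.Permutation.Propositional.Properties using (∈-resp-↭)
open import Data.List.Relation.Unary.All using (All; []; _∷_)
import Data.List.Relation.Unary.All as All
import Data.List.Relation.Unary.All.Properties as All
open import Data.List.Relation.Unary.All.Properties using (all⁺; all⁻)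
import Data.List.Relation.Unary.AllPairs as AllPairs
import Data.List.Relation.Unary.AllPairs.Properties as AllPairs
open import Data.List.Relation.Unary.Any using (here; there; satisfied)
open import Data.List.Relation.Unary.Unique.Propositional using (Unique)
import Data.List.Relation.Unary.Unique.Propositional.Properties as Unique
open import Data.List.Relation.Unary.Unique.Propositional.Properties
  using (applyUpTo⁺₁; upTo⁺; concat⁺; Unique[x∷xs]⇒x∉xs)
open import Data.Maybe using (just)
open import Data.Maybe.Properties using (just-injective)
open import Data.Nat using (ℕ; zero; suc; _<_; _≤_; _+_; _∸_; z≤n; s≤s; s≤s⁻¹; z<s; _≟_; _≤?_; _<ᵇ_; _≡ᵇ_)
open import Data.Nat.Properties
open import Data.Product using (_×_; _,_; ∃; ∃-syntax; proj₁; proj₂)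
open import Data.Sum using (_⊎_; inj₁; inj₂)
import Data.Sum as Sum
open import Data.Unit using (⊤; tt)
open import Function.Base using (_∘_)
open import Function.Bundles using (Equivalence)
open import Relation.Binary.PropositionalEquality
  using (_≡_; _≢_; refl; sym; trans; cong; cong₂; subst; subst₂; module ≡-Reasoning)
open import Relation.Binary.PropositionalEquality.Properties using (setoid)
open import Relation.Nullary using (¬_; yes; no; ¬?; _×-dec_)
open import Relation.Nullary.Decidable using (dec-true; dec-false)
open import Data.List.Membership.DecPropositional (≡-dec _≟_) using (_∈?_)
open import Data.List.Relation.Binary.Permutation.Setoid.Properties (setoid Word) using (Unique-resp-↭)

-- Lexicographic order

data Lex : Word → Word → Set where
  lnil : ∀ {ys} → Lex [] ys
  llt  : ∀ {x y xs ys} → x < y → Lex (x ∷ xs) (y ∷ ys)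
  leq  : ∀ {x xs ys} → Lex xs ys → Lex (x ∷ xs) (x ∷ ys)

Lex-refl : ∀ xs → Lex xs xs
Lex-refl []       = lnil
Lex-refl (x ∷ xs) = leq (Lex-refl xs)

Lex-reflexive : ∀ {xs ys} → xs ≡ ys → Lex xs ys
Lex-reflexive {xs} refl = Lex-refl xs

Lex-antisym : ∀ {xs ys} → Lex xs ys → Lex ys xs → xs ≡ ys
Lex-antisym lnil    lnil    = refl
Lex-antisym (llt p) (llt q) = ⊥-elim (<-asym p q)
Lex-antisym (llt p) (leq _) = ⊥-elim (<-irrefl refl p)
Lex-antisym (leq _) (llt q) = ⊥-elim (<-irrefl refl q)
Lex-antisym (leq p) (leq q) = cong (_ ∷_) (Lex-antisym p q)

lexLeq⇒Lex : ∀ xs ys → lexLeq xs ys ≡ true → Lex xs ys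
lexLeq⇒Lex []       ys       _ = lnil
lexLeq⇒Lex (x ∷ xs) []       ()
lexLeq⇒Lex (x ∷ xs) (y ∷ ys) e with x <ᵇ y in x<ᵇy
... | true = llt (<ᵇ⇒< x y (subst T (sym x<ᵇy) tt))
... | false with x ≡ᵇ y in x≡ᵇy
...   | true with refl ← ≡ᵇ⇒≡ x y (subst T (sym x≡ᵇy) tt) = leq (lexLeq⇒Lex xs ys e)

Lex⇒lexLeq : ∀ {xs ys} → Lex xs ys → lexLeq xs ys ≡ true
Lex⇒lexLeq lnil = refl
Lex⇒lexLeq {x ∷ _} {y ∷ _} (llt x<y) with x <ᵇ y in x<ᵇy
... | true  = refl
... | false = ⊥-elim (subst T x<ᵇy (<⇒<ᵇ x<y))
Lex⇒lexLeq {x ∷ _} (leq p) with x <ᵇ x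
... | true = refl
... | false with x ≡ᵇ x in x≡ᵇx
...   | true  = Lex⇒lexLeq p
...   | false = ⊥-elim (subst T x≡ᵇx (≡⇒≡ᵇ x x refl))

AllZero : Word → Set
AllZero = All (_≡ 0)

AllZero⇒replicate : ∀ {xs} → AllZero xs → xs ≡ replicate (length xs) 0
AllZero⇒replicate []         = refl
AllZero⇒replicate (refl ∷ p) = cong (0 ∷_) (AllZero⇒replicate p)

AllZero-Lex : ∀ {xs ys} → AllZero xs → length xs ≤ length ys → Lex xs ys
AllZero-Lex {[]}                 _          _         = lnil
AllZero-Lex {_ ∷ _} {zero ∷ _}   (refl ∷ p) (s≤s l)   = leq (AllZero-Lex p l)
AllZero-Lex {_ ∷ _} {suc _ ∷ _}  (refl ∷ _) _         = llt z<s

Lex-AllZero : ∀ {xs ys} → AllZero ys → Lex xs ys → AllZero xs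
Lex-AllZero _          lnil    = []
Lex-AllZero (refl ∷ _) (llt ())
Lex-AllZero (refl ∷ p) (leq q) = refl ∷ Lex-AllZero p q

head-of-zeros : ∀ a xs {z zs} → replicate a 0 ≡ xs ++ z ∷ zs → z ≡ 0
head-of-zeros a xs eq with All.++⁻ʳ xs (subst AllZero eq (All.replicate⁺ a refl))
... | z≡0 ∷ _ = z≡0

replicate-∷ʳ : ∀ a (x : ℕ) → replicate a x ++ [ x ] ≡ x ∷ replicate a x
replicate-∷ʳ zero    x = refl
replicate-∷ʳ (suc a) x = cong (x ∷_) (replicate-∷ʳ a x)

reverse-replicate : ∀ a (x : ℕ) → reverse (replicate a x) ≡ replicate a x
reverse-replicate zero    x = refl
reverse-replicate (suc a) x = begin
  reverse (x ∷ replicate a x)     ≡⟨ unfold-reverse x (replicate a x) ⟩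
  reverse (replicate a x) ++ [ x ] ≡⟨ cong (_++ [ x ]) (reverse-replicate a x) ⟩
  replicate a x ++ [ x ]           ≡⟨ replicate-∷ʳ a x ⟩
  x ∷ replicate a x                ∎
  where open ≡-Reasoning

AllZero-reverse : ∀ {xs} → AllZero xs → AllZero (reverse xs)
AllZero-reverse {xs} p =
  subst AllZero (sym (trans (cong reverse (AllZero⇒replicate p)) (reverse-replicate (length xs) 0)))
    (All.replicate⁺ (length xs) refl)

-- Conjugacy and rotation-maximal words

split-++ : ∀ (q r c d : Word) → q ++ r ≡ c ++ d →
  (∃ λ e → q ≡ c ++ e × d ≡ e ++ r) ⊎ (∃ λ e → c ≡ q ++ e × r ≡ e ++ d)
split-++ []      r c       d eq = inj₂ (c , refl , eq)
split-++ (x ∷ q) r []      d eq = inj₁ (x ∷ q , refl , sym eq)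
split-++ (x ∷ q) r (y ∷ c) d eq with refl , eq′ ← ∷-injective eq with split-++ q r c d eq′
... | inj₁ (e , q≡ce , d≡er) = inj₁ (e , cong (x ∷_) q≡ce , d≡er)
... | inj₂ (e , c≡qe , r≡ed) = inj₂ (e , cong (x ∷_) c≡qe , r≡ed)

Conjugate : Word → Word → Set
Conjugate x y = ∃ λ a → ∃ λ b → x ≡ a ++ b × y ≡ b ++ a

Conjugate-refl : ∀ x → Conjugate x x
Conjugate-refl x = [] , x , refl , sym (++-identityʳ x)

Conjugate-sym : ∀ {x y} → Conjugate x y → Conjugate y x
Conjugate-sym (a , b , x≡ab , y≡ba) = b , a , y≡ba , x≡ab

Conjugate-trans : ∀ {x y z} → Conjugate x y → Conjugate y z → Conjugate x z
Conjugate-trans (a , b , refl , refl) (c , d , ba≡cd , refl) with split-++ b a c d ba≡cd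
... | inj₁ (e , refl , refl) = a ++ c , e , sym (++-assoc a c e) , ++-assoc e a c
... | inj₂ (e , refl , refl) = e , d ++ b , ++-assoc e d b , sym (++-assoc d b e)

Conjugate-length : ∀ {x y} → Conjugate x y → length x ≡ length y
Conjugate-length (a , b , refl , refl) = length-++-comm a b

Conjugate-AllZero : ∀ {x y} → Conjugate x y → AllZero y → AllZero x
Conjugate-AllZero (a , b , refl , refl) z = All.++⁺ (All.++⁻ʳ b z) (All.++⁻ˡ b z)

Conjugate-reverse : ∀ {x y} → Conjugate x y → Conjugate (reverse x) (reverse y)
Conjugate-reverse (a , b , refl , refl) = reverse b , reverse a , reverse-++ a b , reverse-++ b a

LexMaxRot : Word → Set
LexMaxRot p = ∀ c d → p ≡ c ++ d → Lex (d ++ c) p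

LexMaxRot-conjugate : ∀ {p p′} → LexMaxRot p → LexMaxRot p′ → Conjugate p p′ → p ≡ p′
LexMaxRot-conjugate {p} {p′} H H′ (c , d , p≡cd , p′≡dc) =
  Lex-antisym (subst (λ z → Lex z p′) (sym p≡cd) (H′ d c p′≡dc))
              (subst (λ z → Lex z p) (sym p′≡dc) (H c d p≡cd))

LexMaxRot-zeros : ∀ a → LexMaxRot (replicate a 0)
LexMaxRot-zeros a c d eq = AllZero-Lex (Conjugate-AllZero (d , c , refl , refl) zeros)
  (≤-reflexive (trans (length-++-comm d c) (cong length (sym eq))))
  where
  zeros : AllZero (c ++ d)
  zeros = subst AllZero eq (All.replicate⁺ a refl)

Lex-lower : ∀ {v s} (e q : Word) {T U T′ U′ : Word} → length e < length q → v < s →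
            Lex (e ++ s ∷ T) (q ++ U) → Lex (e ++ v ∷ T′) (q ++ U′)
Lex-lower []      (y ∷ q) _       v<s (llt s<y) = llt (<-trans v<s s<y)
Lex-lower []      (y ∷ q) _       v<s (leq _)   = llt v<s
Lex-lower (x ∷ e) (y ∷ q) _       _   (llt x<y) = llt x<y
Lex-lower (x ∷ e) (x ∷ q) (s≤s l) v<s (leq p)   = leq (Lex-lower e q l v<s p)

LexMaxRot-∷zeros : ∀ v a → LexMaxRot (v ∷ replicate a 0)
LexMaxRot-∷zeros zero    a = LexMaxRot-zeros (suc a)
LexMaxRot-∷zeros (suc v) a c       []      eq = Lex-reflexive (sym (trans eq (++-identityʳ c)))
LexMaxRot-∷zeros (suc v) a []      d       eq = Lex-reflexive (trans (++-identityʳ d) (sym eq))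
LexMaxRot-∷zeros (suc v) a (_ ∷ c) (z ∷ d) eq =
  llt (subst (_< suc v) (sym (head-of-zeros a c (proj₂ (∷-injective eq)))) z<s)

-- A rotation cut inside q is compared within q, where nothing changed; one cut in the tail
-- starts with a letter at most v, which is below s, and s is at most the first letter of q.
module _ {s v : ℕ} (a : ℕ) (v<s : v < s) where
  private
    Z : Word
    Z = replicate a 0

  lower-cut-in-prefix : ∀ c e → LexMaxRot ((c ++ e) ++ s ∷ Z) →
    Lex ((e ++ v ∷ Z) ++ c) ((c ++ e) ++ v ∷ Z)
  lower-cut-in-prefix [] e _ = Lex-reflexive (++-identityʳ _)
  lower-cut-in-prefix c@(_ ∷ _) e H =
    subst (λ z → Lex z ((c ++ e) ++ v ∷ Z)) (sym (++-assoc e (v ∷ Z) c))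
      (Lex-lower e (c ++ e) (subst (length e <_) (sym (length-++ c)) (m<n+m (length e) z<s)) v<s
        (subst (λ z → Lex z ((c ++ e) ++ s ∷ Z)) (++-assoc e (s ∷ Z) c)
          (H c (e ++ s ∷ Z) (++-assoc c e (s ∷ Z)))))

  lower-cut-in-suffix : ∀ q e d → LexMaxRot (q ++ s ∷ Z) → v ∷ Z ≡ e ++ d →
    Lex (d ++ q ++ e) (q ++ v ∷ Z)
  lower-cut-in-suffix q e [] _ eq = Lex-reflexive (cong (q ++_) (sym (trans eq (++-identityʳ e))))
  lower-cut-in-suffix [] e d _ eq = LexMaxRot-∷zeros v a e d eq
  lower-cut-in-suffix (y ∷ q) e (z ∷ d) H eq = llt (≤-<-trans (z≤v e eq) (<-≤-trans v<s s≤y))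
    where
    s≤y : s ≤ y
    s≤y with H (y ∷ q) (s ∷ Z) refl
    ... | llt s<y = <⇒≤ s<y
    ... | leq _   = ≤-refl
    z≤v : ∀ e → v ∷ Z ≡ e ++ z ∷ d → z ≤ v
    z≤v []       refl = ≤-refl
    z≤v (_ ∷ e′) eq   = subst (_≤ v) (sym (head-of-zeros a e′ (proj₂ (∷-injective eq)))) z≤n

  LexMaxRot-lower-strict : ∀ q → LexMaxRot (q ++ s ∷ Z) → LexMaxRot (q ++ v ∷ Z)
  LexMaxRot-lower-strict q H c d eq with split-++ q (v ∷ Z) c d eq
  ... | inj₁ (e , refl , refl) = lower-cut-in-prefix c e H
  ... | inj₂ (e , refl , vZ≡ed) = lower-cut-in-suffix q e d H vZ≡ed

LexMaxRot-lower : ∀ q {s v} a → LexMaxRot (q ++ s ∷ replicate a 0) → v ≤ s →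
  LexMaxRot (q ++ v ∷ replicate a 0)
LexMaxRot-lower q a H v≤s with m≤n⇒m<n∨m≡n v≤s
... | inj₁ v<s  = LexMaxRot-lower-strict a v<s q H
... | inj₂ refl = H

-- Key-words

IsKeyWord : Word → Set
IsKeyWord w = LexMaxRot (reverse w)

reverse-0ᵃσw : ∀ a s w → reverse (replicate a 0 ++ s ∷ w) ≡ reverse w ++ s ∷ replicate a 0
reverse-0ᵃσw a s w = begin
  reverse (replicate a 0 ++ s ∷ w)             ≡⟨ reverse-++ (replicate a 0) (s ∷ w) ⟩
  reverse (s ∷ w) ++ reverse (replicate a 0)    ≡⟨ cong₂ _++_ (unfold-reverse s w) (reverse-replicate a 0) ⟩
  (reverse w ++ [ s ]) ++ replicate a 0         ≡⟨ ++-assoc (reverse w) [ s ] _ ⟩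
  reverse w ++ s ∷ replicate a 0                ∎
  where open ≡-Reasoning

IsKeyWord-lower : ∀ a {s v} w → IsKeyWord (replicate a 0 ++ s ∷ w) → v ≤ s →
  IsKeyWord (replicate a 0 ++ v ∷ w)
IsKeyWord-lower a {s} {v} w H v≤s = subst LexMaxRot (sym (reverse-0ᵃσw a v w))
  (LexMaxRot-lower (reverse w) a (subst LexMaxRot (reverse-0ᵃσw a s w) H) v≤s)

IsKeyWord-conjugate : ∀ {x y} → IsKeyWord x → IsKeyWord y → Conjugate x y → x ≡ y
IsKeyWord-conjugate Hx Hy x~y = reverse-injective (LexMaxRot-conjugate Hx Hy (Conjugate-reverse x~y))

drop-length-++ : ∀ (a b : Word) → drop (length a) (a ++ b) ≡ b
drop-length-++ []      b = refl
drop-length-++ (_ ∷ a) b = drop-length-++ a b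

take-length-++ : ∀ (a b : Word) → take (length a) (a ++ b) ≡ a
take-length-++ []      b = refl
take-length-++ (x ∷ a) b = cong (x ∷_) (take-length-++ a b)

rot-length-++ : ∀ (a b : Word) → rot (length a) (a ++ b) ≡ b ++ a
rot-length-++ a b = cong₂ _++_ (drop-length-++ a b) (take-length-++ a b)

rot-Conjugate : ∀ i w → Conjugate (rot i w) w
rot-Conjugate i w = drop i w , take i w , refl , sym (take++drop≡id i w)

isKey⇒IsKeyWord : ∀ w → T (isKey w) → IsKeyWord w
isKey⇒IsKeyWord w _  []      d eq = Lex-reflexive (trans (++-identityʳ d) (sym eq))
isKey⇒IsKeyWord w ok (x ∷ c) d eq =
  subst₂ Lex reverse-ba refl (subst (λ z → Lex (reverse z) (reverse w)) rot-w (lexLeq⇒Lex _ _ colex))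
  where
  a b : Word
  a = reverse d
  b = reverse (x ∷ c)
  w≡ab : w ≡ a ++ b
  w≡ab = trans (sym (reverse-involutive w)) (trans (cong reverse eq) (reverse-++ (x ∷ c) d))
  a<w : length a < length w
  a<w = subst (length a <_) (sym (trans (cong length w≡ab) (length-++ a)))
          (subst (λ z → length a < length a + z) (sym (length-reverse (x ∷ c))) (m<m+n (length a) z<s))
  colex : colexLeq (rot (length a) w) w ≡ true
  colex = Equivalence.to T-≡ (All.lookup (all⁺ (λ i → colexLeq (rot i w) w) (upTo (length w)) ok) (∈-upTo⁺ a<w))
  rot-w : rot (length a) w ≡ b ++ a
  rot-w = trans (cong (rot (length a)) w≡ab) (rot-length-++ a b)
  reverse-ba : reverse (b ++ a) ≡ d ++ x ∷ c
  reverse-ba = trans (reverse-++ b a) (cong₂ _++_ (reverse-involutive d) (reverse-involutive (x ∷ c)))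

isKey-zeros : ∀ n → T (isKey (replicate n 0))
isKey-zeros n = all⁻ (λ i → colexLeq (rot i z) z) {upTo (length z)}
  (All.tabulate λ {i} _ → Equivalence.from T-≡ (Lex⇒lexLeq (rotation-Lex i)))
  where
  z : Word
  z = replicate n 0
  rotation-Lex : ∀ i → Lex (reverse (rot i z)) (reverse z)
  rotation-Lex i = AllZero-Lex (AllZero-reverse (Conjugate-AllZero (rot-Conjugate i z) (All.replicate⁺ n refl)))
    (≤-reflexive (trans (length-reverse (rot i z)) (trans (Conjugate-length (rot-Conjugate i z)) (sym (length-reverse z)))))

-- Rotations, periods and orbits

==ʷ⇒≡ : ∀ {u v} → (u ==ʷ v) ≡ true → u ≡ v
==ʷ⇒≡ {u} {v} e with ≡-dec _≟_ u v | e
... | yes u≡v | _ = u≡v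
... | no _    | ()

==ʷ⇒≢ : ∀ {u v} → (u ==ʷ v) ≡ false → u ≢ v
==ʷ⇒≢ {u} {v} e with ≡-dec _≟_ u v | e
... | no u≢v | _ = u≢v
... | yes _  | ()

∷ʳ≢[] : ∀ (xs : Word) {x} → xs ++ [ x ] ≢ []
∷ʳ≢[] []      ()
∷ʳ≢[] (_ ∷ _) ()

rot1^ : ℕ → Word → Word
rot1^ zero    w = w
rot1^ (suc i) w = rot1^ i (rot1 w)

rot1^-suc : ∀ i w → rot1^ (suc i) w ≡ rot1 (rot1^ i w)
rot1^-suc zero    w = refl
rot1^-suc (suc i) w = rot1^-suc i (rot1 w)

rot1^-+ : ∀ i j w → rot1^ (i + j) w ≡ rot1^ i (rot1^ j w)
rot1^-+ zero    j w = refl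
rot1^-+ (suc i) j w = begin
  rot1^ (suc i + j) w      ≡⟨ rot1^-suc (i + j) w ⟩
  rot1 (rot1^ (i + j) w)   ≡⟨ cong rot1 (rot1^-+ i j w) ⟩
  rot1 (rot1^ i (rot1^ j w)) ≡⟨ sym (rot1^-suc i (rot1^ j w)) ⟩
  rot1^ (suc i) (rot1^ j w) ∎
  where open ≡-Reasoning

rot1^-comm : ∀ i j w → rot1^ i (rot1^ j w) ≡ rot1^ j (rot1^ i w)
rot1^-comm i j w = trans (sym (rot1^-+ i j w)) (trans (cong (λ z → rot1^ z w) (+-comm i j)) (rot1^-+ j i w))

rot1-injective : ∀ {x y} → rot1 x ≡ rot1 y → x ≡ y
rot1-injective {[]}    {[]}    _  = refl
rot1-injective {[]}    {y ∷ ys} eq = ⊥-elim (∷ʳ≢[] ys (sym eq))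
rot1-injective {x ∷ xs} {[]}    eq = ⊥-elim (∷ʳ≢[] xs eq)
rot1-injective {x ∷ xs} {y ∷ ys} eq with refl , refl ← ∷ʳ-injective xs ys eq = refl

rot1^-injective : ∀ i {x y} → rot1^ i x ≡ rot1^ i y → x ≡ y
rot1^-injective zero    eq = eq
rot1^-injective (suc i) eq = rot1-injective (rot1^-injective i eq)

rot1^-Conjugate : ∀ i w → Conjugate (rot1^ i w) w
rot1^-Conjugate zero    w        = Conjugate-refl w
rot1^-Conjugate (suc i) []       = rot1^-Conjugate i []
rot1^-Conjugate (suc i) (x ∷ xs) = Conjugate-trans (rot1^-Conjugate i (xs ++ [ x ])) (xs , [ x ] , refl , refl)

rot1^-length-++ : ∀ (a b : Word) → rot1^ (length a) (a ++ b) ≡ b ++ a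
rot1^-length-++ []      b = sym (++-identityʳ b)
rot1^-length-++ (x ∷ a) b = begin
  rot1^ (length a) ((a ++ b) ++ [ x ]) ≡⟨ cong (rot1^ (length a)) (++-assoc a b [ x ]) ⟩
  rot1^ (length a) (a ++ b ++ [ x ])   ≡⟨ rot1^-length-++ a (b ++ [ x ]) ⟩
  (b ++ [ x ]) ++ a                    ≡⟨ ++-assoc b [ x ] a ⟩
  b ++ x ∷ a                           ∎
  where open ≡-Reasoning

rot≡rot1^ : ∀ i w → i ≤ length w → rot i w ≡ rot1^ i w
rot≡rot1^ i w i≤w = begin
  drop i w ++ take i w                  ≡⟨ sym (rot1^-length-++ (take i w) (drop i w)) ⟩
  rot1^ |take| (take i w ++ drop i w)   ≡⟨ cong₂ rot1^ |take|≡i (take++drop≡id i w) ⟩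
  rot1^ i w                             ∎
  where
  open ≡-Reasoning
  |take| = length (take i w)
  |take|≡i : |take| ≡ i
  |take|≡i = trans (length-take i w) (m≤n⇒m⊓n≡m i≤w)

rot-length : ∀ w → rot (length w) w ≡ w
rot-length w = cong₂ _++_ (drop-all (length w) w ≤-refl) (take-all (length w) w ≤-refl)

IsLeastRotPeriod : Word → ℕ → Set
IsLeastRotPeriod w P = 1 ≤ P × rot P w ≡ w × (∀ j → 1 ≤ j → j < P → rot j w ≢ w)

periodAux-least : ∀ fuel i w → 1 ≤ i → length w ≤ i + fuel →
  (∀ j → 1 ≤ j → j < i → rot j w ≢ w) → IsLeastRotPeriod w (periodAux fuel i w)
periodAux-least zero i w 1≤i w≤i below =
  1≤i , trans (cong₂ _++_ (drop-all i w w≤i′) (take-all i w w≤i′)) refl , below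
  where
  w≤i′ : length w ≤ i
  w≤i′ = subst (length w ≤_) (+-identityʳ i) w≤i
periodAux-least (suc fuel) i w 1≤i w≤i below with rot i w ==ʷ w in returns
... | true  = 1≤i , ==ʷ⇒≡ returns , below
... | false = periodAux-least fuel (suc i) w (m≤n⇒m≤1+n 1≤i) (subst (length w ≤_) (+-suc i fuel) w≤i) below′
  where
  below′ : ∀ j → 1 ≤ j → j < suc i → rot j w ≢ w
  below′ j 1≤j j≤i with m≤n⇒m<n∨m≡n (s≤s⁻¹ j≤i)
  ... | inj₁ j<i  = below j 1≤j j<i
  ... | inj₂ refl = ==ʷ⇒≢ returns

period-least : ∀ w → IsLeastRotPeriod w (period w)
period-least w = periodAux-least (length w) 1 w ≤-refl (n≤1+n (length w))
  (λ j 1≤j j<1 _ → <-irrefl refl (≤-trans j<1 1≤j))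

iterate-rot1 : ∀ m y → iterate rot1 y m ≡ applyUpTo (λ i → rot1^ i y) m
iterate-rot1 zero    y = refl
iterate-rot1 (suc m) y = cong (y ∷_) (iterate-rot1 m (rot1 y))

module Orbit (K : Word) (K≢[] : 1 ≤ length K) where

  P : ℕ
  P = period K

  P≥1 : 1 ≤ P
  P≥1 = proj₁ (period-least K)

  P≤length : P ≤ length K
  P≤length with P ≤? length K
  ... | yes P≤K = P≤K
  ... | no  P≰K = ⊥-elim (proj₂ (proj₂ (period-least K)) (length K) K≢[] (≰⇒> P≰K) (rot-length K))

  rot1^-period : rot1^ P K ≡ K
  rot1^-period = trans (sym (rot≡rot1^ P K P≤length)) (proj₁ (proj₂ (period-least K)))

  rot1^-below-period : ∀ d → 1 ≤ d → d < P → rot1^ d K ≢ K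
  rot1^-below-period d 1≤d d<P eq =
    proj₂ (proj₂ (period-least K)) d 1≤d d<P (trans (rot≡rot1^ d K (≤-trans (<⇒≤ d<P) P≤length)) eq)

  module From (e : ℕ) where

    y : Word
    y = rot1^ e K

    orbit : List Word
    orbit = iterate rot1 y P

    ∈-orbit⇒Conjugate : ∀ {x} → x ∈ orbit → Conjugate x K
    ∈-orbit⇒Conjugate x∈ with i , _ , refl ← ∈-applyUpTo⁻ _ (subst (_ ∈_) (iterate-rot1 P y) x∈) =
      Conjugate-trans (rot1^-Conjugate i y) (rot1^-Conjugate e K)

    orbit-unique : Unique orbit
    orbit-unique = subst Unique (sym (iterate-rot1 P y)) (applyUpTo⁺₁ _ P distinct)
      where
      distinct : ∀ {i j} → i < j → j < P → rot1^ i y ≢ rot1^ j y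
      distinct {i} {j} i<j j<P eq = rot1^-below-period (j ∸ i) (m<n⇒0<n∸m i<j) (≤-<-trans (m∸n≤m j i) j<P)
        (sym (rot1^-injective e (trans y≡ (rot1^-comm (j ∸ i) e K))))
        where
        y≡ : y ≡ rot1^ (j ∸ i) y
        y≡ = rot1^-injective i (begin
          rot1^ i y               ≡⟨ eq ⟩
          rot1^ j y               ≡⟨ cong (λ z → rot1^ z y) (sym (m+[n∸m]≡n (<⇒≤ i<j))) ⟩
          rot1^ (i + (j ∸ i)) y   ≡⟨ rot1^-+ i (j ∸ i) y ⟩
          rot1^ i (rot1^ (j ∸ i) y) ∎)
          where open ≡-Reasoning

    P≡suc : P ≡ suc (P ∸ 1)
    P≡suc = sym (m+[n∸m]≡n P≥1)

    orbit-head : ∃ λ S → orbit ≡ y ∷ S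
    orbit-head = iterate rot1 (rot1 y) (P ∸ 1) , cong (iterate rot1 y) P≡suc

    orbit-last : ∀ {L} → rot1 L ≡ y → ∃ λ S → orbit ≡ S ++ [ L ]
    orbit-last {L} rot1L≡y = applyUpTo f (P ∸ 1) , (begin
      iterate rot1 y P                    ≡⟨ iterate-rot1 P y ⟩
      applyUpTo f P                       ≡⟨ cong (applyUpTo f) P≡suc ⟩
      applyUpTo f (suc (P ∸ 1))           ≡⟨ sym (applyUpTo-∷ʳ f (P ∸ 1)) ⟩
      applyUpTo f (P ∸ 1) ++ [ f (P ∸ 1) ] ≡⟨ cong (λ z → applyUpTo f (P ∸ 1) ++ [ z ]) last≡L ⟩
      applyUpTo f (P ∸ 1) ++ [ L ]        ∎)
      where
      open ≡-Reasoning
      f : ℕ → Word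
      f i = rot1^ i y
      y-periodic : rot1^ P y ≡ y
      y-periodic = trans (rot1^-comm P e K) (cong (rot1^ e) rot1^-period)
      last≡L : f (P ∸ 1) ≡ L
      last≡L = rot1-injective (begin
        rot1 (rot1^ (P ∸ 1) y) ≡⟨ sym (rot1^-suc (P ∸ 1) y) ⟩
        rot1^ (suc (P ∸ 1)) y  ≡⟨ cong (λ z → rot1^ z y) (sym P≡suc) ⟩
        rot1^ P y              ≡⟨ y-periodic ⟩
        y                      ≡⟨ sym rot1L≡y ⟩
        rot1 L                 ∎)

-- The sorted list of key-words

allWords-length : ∀ n k {x} → x ∈ allWords n k → length x ≡ n
allWords-length zero    k (here refl) = refl
allWords-length (suc n) k x∈
  with _ , x∈a ← satisfied (∈-concatMap⁻ (λ a → map (a ∷_) (allWords n k)) {upTo k} x∈)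
  with _ , ws∈ , refl ← map∷⁻ x∈a = cong suc (allWords-length n k ws∈)

zeros∈allWords : ∀ n k → replicate n 0 ∈ allWords n (suc k)
zeros∈allWords zero    k = here refl
zeros∈allWords (suc n) k =
  ∈-concatMap⁺ (λ a → map (a ∷_) (allWords n (suc k))) {upTo (suc k)} (here (∈-map⁺ (0 ∷_) (zeros∈allWords n k)))

allWords-unique : ∀ n k → Unique (allWords n k)
allWords-unique zero    k = [] AllPairs.∷ AllPairs.[]
allWords-unique (suc n) k = concat⁺
  (All.map⁺ (All.universal (λ a → Unique.map⁺ ∷-injectiveʳ (allWords-unique n k)) (upTo k)))
  (AllPairs.map⁺ (AllPairs.map different-heads (upTo⁺ k)))
  where
  different-heads : ∀ {a b} → a ≢ b → Disjoint (map (a ∷_) (allWords n k)) (map (b ∷_) (allWords n k))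
  different-heads a≢b (v∈a , v∈b) with _ , _ , refl ← map∷⁻ v∈a = a≢b (proj₁ (map∷-decomp∈ v∈b))

insertColex-↭ : ∀ w ws → insertColex w ws ↭ w ∷ ws
insertColex-↭ w []       = ↭-refl
insertColex-↭ w (x ∷ ws) with colexLeq w x
... | true  = ↭-refl
... | false = ↭-trans (↭-prep x (insertColex-↭ w ws)) (↭-swap x w ↭-refl)

sortColex-↭ : ∀ ws → sortColex ws ↭ ws
sortColex-↭ []       = ↭-refl
sortColex-↭ (w ∷ ws) = ↭-trans (insertColex-↭ w (sortColex ws)) (↭-prep w (sortColex-↭ ws))

colexLeq-zeros : ∀ n y → length y ≡ n → colexLeq (replicate n 0) y ≡ true
colexLeq-zeros n y |y|≡n = Lex⇒lexLeq (subst (λ z → Lex z (reverse y)) (sym (reverse-replicate n 0))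
  (AllZero-Lex (All.replicate⁺ n refl) (≤-reflexive (trans (length-replicate n) (sym (trans (length-reverse y) |y|≡n))))))

colexLeq-above-zeros : ∀ n y → length y ≡ n → y ≢ replicate n 0 → colexLeq y (replicate n 0) ≡ false
colexLeq-above-zeros n y |y|≡n y≢0 with colexLeq y (replicate n 0) in y≤0
... | false = refl
... | true  = ⊥-elim (y≢0 (reverse-injective (trans (AllZero⇒replicate zeros) (begin
    replicate (length (reverse y)) 0 ≡⟨ cong (λ m → replicate m 0) (trans (length-reverse y) |y|≡n) ⟩
    replicate n 0                    ≡⟨ sym (reverse-replicate n 0) ⟩
    reverse (replicate n 0)          ∎))))
  where
  open ≡-Reasoning
  zeros : AllZero (reverse y)
  zeros = Lex-AllZero (subst AllZero (sym (reverse-replicate n 0)) (All.replicate⁺ n refl)) (lexLeq⇒Lex _ _ y≤0)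

sortColex-zeros-first : ∀ n ws → (∀ {y} → y ∈ ws → length y ≡ n) → replicate n 0 ∈ ws → Unique ws →
  ∃ λ S → sortColex ws ≡ replicate n 0 ∷ S
sortColex-zeros-first n (w ∷ ws) lengths (here refl) _ = insert-first (sortColex ws)
  (λ y∈ → lengths (there (∈-resp-↭ (sortColex-↭ ws) y∈)))
  where
  insert-first : ∀ S → (∀ {y} → y ∈ S → length y ≡ n) →
    ∃ λ S′ → insertColex (replicate n 0) S ≡ replicate n 0 ∷ S′
  insert-first []      _       = [] , refl
  insert-first (y ∷ S) lengthsS rewrite colexLeq-zeros n y (lengthsS (here refl)) = y ∷ S , refl
sortColex-zeros-first n (w ∷ ws) lengths (there 0∈) (w∉ AllPairs.∷ unique)
  with S , sorted ← sortColex-zeros-first n ws (λ y∈ → lengths (there y∈)) 0∈ unique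
  rewrite sorted
        | colexLeq-above-zeros n w (lengths (here refl)) (λ w≡0 → All.lookup w∉ (subst (_∈ ws) (sym w≡0) 0∈) refl)
  = insertColex w S , refl

nthD-∈ : ∀ d (L : List Word) m → m < length L → nthD d L m ∈ L
nthD-∈ d (x ∷ L) zero    _       = here refl
nthD-∈ d (x ∷ L) (suc m) (s≤s l) = there (nthD-∈ d L m l)

nthD-injective : ∀ d (L : List Word) {p q} → Unique L → p < length L → q < length L →
  nthD d L p ≡ nthD d L q → p ≡ q
nthD-injective d (x ∷ L) {zero}  {zero}  _ _ _ _ = refl
nthD-injective d (x ∷ L) {zero}  {suc q} u _ (s≤s q<L) eq =
  ⊥-elim (Unique[x∷xs]⇒x∉xs u (subst (_∈ L) (sym eq) (nthD-∈ d L q q<L)))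
nthD-injective d (x ∷ L) {suc p} {zero}  u (s≤s p<L) _ eq =
  ⊥-elim (Unique[x∷xs]⇒x∉xs u (subst (_∈ L) eq (nthD-∈ d L p p<L)))
nthD-injective d (x ∷ L) {suc p} {suc q} (_ AllPairs.∷ u) (s≤s p<L) (s≤s q<L) eq =
  cong suc (nthD-injective d L u p<L q<L eq)

key₀ : ∀ n k → 0 < c n k → key n k 0 ≡ replicate n 0
key₀ zero    zero    _  = refl
key₀ (suc n) zero    ()
key₀ n       (suc k) _
  with S , sorted ← sortColex-zeros-first n (filterᵇ isKey (allWords n (suc k)))
                      (λ y∈ → allWords-length n (suc k) (proj₁ (∈-filter⁻ (T? ∘ isKey) y∈)))
                      (∈-filter⁺ (T? ∘ isKey) (zeros∈allWords n k) (isKey-zeros n))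
                      (Unique.filter⁺ (T? ∘ isKey) (allWords-unique n (suc k)))
  = cong (λ L → nthD (replicate n 0) L 0) sorted

module Keys (n k : ℕ) where

  ∈-keyList⁻ : ∀ {x} → x ∈ keyList n k → x ∈ allWords n k × T (isKey x)
  ∈-keyList⁻ x∈ = ∈-filter⁻ (T? ∘ isKey) (∈-resp-↭ (sortColex-↭ _) x∈)

  keyList-unique : Unique (keyList n k)
  keyList-unique =
    Unique-resp-↭ (↭⇒↭ₛ (↭-sym (sortColex-↭ _))) (Unique.filter⁺ (T? ∘ isKey) (allWords-unique n k))

  key-∈ : ∀ {m} → m < c n k → key n k m ∈ keyList n k
  key-∈ {m} = nthD-∈ (replicate n 0) (keyList n k) m

  key-IsKeyWord : ∀ {m} → m < c n k → IsKeyWord (key n k m)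
  key-IsKeyWord {m} m<c = isKey⇒IsKeyWord (key n k m) (proj₂ (∈-keyList⁻ (key-∈ m<c)))

  key-length : ∀ {m} → m < c n k → length (key n k m) ≡ n
  key-length m<c = allWords-length n k (proj₁ (∈-keyList⁻ (key-∈ m<c)))

  key-injective : ∀ {p q} → p < c n k → q < c n k → key n k p ≡ key n k q → p ≡ q
  key-injective = nthD-injective (replicate n 0) (keyList n k) keyList-unique

-- Insertion after a word, and blocks

Unique-++⁻ : ∀ xs {ys : List Word} → Unique (xs ++ ys) → Disjoint xs ys
Unique-++⁻ (x ∷ xs) (x∉ AllPairs.∷ _) (here refl , v∈ys) = All.lookup x∉ (∈-++⁺ʳ xs v∈ys) refl
Unique-++⁻ (x ∷ xs) (_ AllPairs.∷ u)  (there v∈xs , v∈ys) = Unique-++⁻ xs u (v∈xs , v∈ys)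

Unique-++⁻ʳ : ∀ xs {ys : List Word} → Unique (xs ++ ys) → Unique ys
Unique-++⁻ʳ []       u                = u
Unique-++⁻ʳ (x ∷ xs) (_ AllPairs.∷ u) = Unique-++⁻ʳ xs u

Unique-++⁻ˡ : ∀ xs {ys : List Word} → Unique (xs ++ ys) → Unique xs
Unique-++⁻ˡ []       _                  = AllPairs.[]
Unique-++⁻ˡ (x ∷ xs) (x∉ AllPairs.∷ u) = All.++⁻ˡ xs x∉ AllPairs.∷ Unique-++⁻ˡ xs u

insertAfter-∉ : ∀ {a} cs L → a ∉ L → insertAfter a cs L ≡ L
insertAfter-∉         cs []      _  = refl
insertAfter-∉ {a} cs (x ∷ L) a∉ rewrite dec-false (≡-dec _≟_ x a) (λ x≡a → a∉ (here (sym x≡a))) =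
  cong (x ∷_) (insertAfter-∉ cs L (a∉ ∘ there))

insertAfter-here : ∀ a cs L → insertAfter a cs (a ∷ L) ≡ a ∷ cs ++ L
insertAfter-here a cs L rewrite dec-true (≡-dec _≟_ a a) refl = refl

insertAfter-++ʳ : ∀ {a} cs A M → a ∉ A → insertAfter a cs (A ++ M) ≡ A ++ insertAfter a cs M
insertAfter-++ʳ         cs []      M _  = refl
insertAfter-++ʳ {a} cs (x ∷ A) M a∉ rewrite dec-false (≡-dec _≟_ x a) (λ x≡a → a∉ (here (sym x≡a))) =
  cong (x ∷_) (insertAfter-++ʳ cs A M (a∉ ∘ there))

insertAfter-++ˡ : ∀ {a} cs A M → a ∈ A → insertAfter a cs (A ++ M) ≡ insertAfter a cs A ++ M
insertAfter-++ˡ {a} cs (x ∷ A) M a∈ with x ==ʷ a in x=a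
... | true  = cong (x ∷_) (sym (++-assoc cs A M))
... | false with a∈
...   | here a≡x  = ⊥-elim (==ʷ⇒≢ x=a (sym a≡x))
...   | there a∈A = cong (x ∷_) (insertAfter-++ˡ cs A M a∈A)

insertAfter-head : ∀ a cs f L → ∃ λ L′ → insertAfter a cs (f ∷ L) ≡ f ∷ L′
insertAfter-head a cs f L with f ==ʷ a
... | true  = cs ++ L , refl
... | false = insertAfter a cs L , refl

insertAfter-split : ∀ {a} cs L → a ∈ L → ∃ λ X → ∃ λ Y → insertAfter a cs L ≡ (X ++ [ a ]) ++ cs ++ Y
insertAfter-split {a} cs (x ∷ L) a∈ with x ==ʷ a in x=a
... | true  with refl ← ==ʷ⇒≡ {x} {a} x=a = [] , L , refl
... | false with a∈
...   | here a≡x  = ⊥-elim (==ʷ⇒≢ x=a (sym a≡x))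
...   | there a∈L with X , Y , eq ← insertAfter-split cs L a∈L = x ∷ X , Y , cong (x ∷_) eq

∈-insertAfter⁻ : ∀ {a x} cs L → x ∈ insertAfter a cs L → x ∈ L ⊎ x ∈ cs
∈-insertAfter⁻ {a} cs (y ∷ L) x∈ with y ==ʷ a
... | true with x∈
...   | here x≡y = inj₁ (here x≡y)
...   | there x∈′ with ∈-++⁻ cs x∈′
...     | inj₁ x∈cs = inj₂ x∈cs
...     | inj₂ x∈L  = inj₁ (there x∈L)
∈-insertAfter⁻ {a} cs (y ∷ L) x∈ | false with x∈
...   | here x≡y  = inj₁ (here x≡y)
...   | there x∈′ = Sum.map₁ there (∈-insertAfter⁻ cs L x∈′)

∈-insertAfter⁺ˡ : ∀ {a x} cs L → x ∈ L → x ∈ insertAfter a cs L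
∈-insertAfter⁺ˡ {a} cs (y ∷ L) x∈ with y ==ʷ a | x∈
... | true  | here x≡y  = here x≡y
... | true  | there x∈L = there (∈-++⁺ʳ cs x∈L)
... | false | here x≡y  = here x≡y
... | false | there x∈L = there (∈-insertAfter⁺ˡ cs L x∈L)

∈-insertAfter⁺ʳ : ∀ {a x} cs L → a ∈ L → x ∈ cs → x ∈ insertAfter a cs L
∈-insertAfter⁺ʳ cs L a∈ x∈cs with X , Y , eq ← insertAfter-split cs L a∈ =
  subst (_ ∈_) (sym eq) (∈-++⁺ʳ (X ++ [ _ ]) (∈-++⁺ˡ x∈cs))

insertAfter-unique : ∀ {a} cs L → Unique L → Unique cs → Disjoint L cs → Unique (insertAfter a cs L)
insertAfter-unique         cs []      _                  _   _    = AllPairs.[]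
insertAfter-unique {a} cs (x ∷ L) (x∉L AllPairs.∷ uL) ucs disj with x ==ʷ a
... | true  = All.¬Any⇒All¬ (cs ++ L) x∉csL
                AllPairs.∷ Unique.++⁺ ucs uL (λ (v∈cs , v∈L) → disj (there v∈L , v∈cs))
  where
  x∉csL : x ∉ cs ++ L
  x∉csL x∈ with ∈-++⁻ cs x∈
  ... | inj₁ x∈cs = disj (here refl , x∈cs)
  ... | inj₂ x∈L  = All.lookup x∉L x∈L refl
... | false = All.¬Any⇒All¬ _ x∉
                AllPairs.∷ insertAfter-unique cs L uL ucs (λ (v∈L , v∈cs) → disj (there v∈L , v∈cs))
  where
  x∉ : x ∉ insertAfter a cs L
  x∉ x∈ with ∈-insertAfter⁻ cs L x∈
  ... | inj₁ x∈L  = All.lookup x∉L x∈L refl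
  ... | inj₂ x∈cs = disj (here refl , x∈cs)

record Block (L : List Word) (f l : Word) (S : List Word) : Set where
  field
    before after rest init : List Word
    L≡ : L ≡ before ++ S ++ after
    S≡f∷rest : S ≡ f ∷ rest
    S≡init∷ʳl : S ≡ init ++ [ l ]

module _ {L f l S} (unique : Unique L) (block : Block L f l S) {a : Word} (cs : List Word) where
  open Block block

  private
    uniqueS : Unique S
    uniqueS = Unique-++⁻ˡ S (Unique-++⁻ʳ before (subst Unique L≡ unique))

    L′≡ : insertAfter a cs L ≡ insertAfter a cs (before ++ S ++ after)
    L′≡ = cong (insertAfter a cs) L≡

  Block-insertAfter-inside : a ∈ S → a ≢ l → Block (insertAfter a cs L) f l (insertAfter a cs S)
  Block-insertAfter-inside a∈S a≢l = record
    { before = before ; after = after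
    ; rest = proj₁ (insertAfter-head a cs f rest) ; init = insertAfter a cs init
    ; L≡ = begin
        insertAfter a cs L                       ≡⟨ L′≡ ⟩
        insertAfter a cs (before ++ S ++ after)  ≡⟨ insertAfter-++ʳ cs before (S ++ after) a∉before ⟩
        before ++ insertAfter a cs (S ++ after)  ≡⟨ cong (before ++_) (insertAfter-++ˡ cs S after a∈S) ⟩
        before ++ insertAfter a cs S ++ after    ∎
    ; S≡f∷rest = trans (cong (insertAfter a cs) S≡f∷rest) (proj₂ (insertAfter-head a cs f rest))
    ; S≡init∷ʳl = trans (cong (insertAfter a cs) S≡init∷ʳl) (insertAfter-++ˡ cs init [ l ] a∈init)
    }
    where
    open ≡-Reasoning
    a∉before : a ∉ before
    a∉before a∈ = Unique-++⁻ before (subst Unique L≡ unique) (a∈ , ∈-++⁺ˡ a∈S)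
    a∈init : a ∈ init
    a∈init with ∈-++⁻ init (subst (a ∈_) S≡init∷ʳl a∈S)
    ... | inj₁ a∈  = a∈
    ... | inj₂ (here a≡l) = ⊥-elim (a≢l a≡l)

  Block-insertAfter-outside : ¬ (a ∈ S × a ≢ l) → Block (insertAfter a cs L) f l S
  Block-insertAfter-outside outside with a ∈? before
  ... | yes a∈before = record
    { before = insertAfter a cs before ; after = after ; rest = rest ; init = init
    ; L≡ = trans L′≡ (insertAfter-++ˡ cs before (S ++ after) a∈before)
    ; S≡f∷rest = S≡f∷rest ; S≡init∷ʳl = S≡init∷ʳl }
  ... | no a∉before with a ∈? S
  ...   | no a∉S = record
    { before = before ; after = insertAfter a cs after ; rest = rest ; init = init
    ; L≡ = trans L′≡ (trans (insertAfter-++ʳ cs before (S ++ after) a∉before)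
                       (cong (before ++_) (insertAfter-++ʳ cs S after a∉S)))
    ; S≡f∷rest = S≡f∷rest ; S≡init∷ʳl = S≡init∷ʳl }
  ...   | yes a∈S with ≡-dec _≟_ a l
  ...     | no a≢l = ⊥-elim (outside (a∈S , a≢l))
  ...     | yes refl = record
    { before = before ; after = cs ++ after ; rest = rest ; init = init
    ; S≡f∷rest = S≡f∷rest ; S≡init∷ʳl = S≡init∷ʳl
    ; L≡ = begin
        insertAfter a cs L
          ≡⟨ L′≡ ⟩
        insertAfter a cs (before ++ S ++ after)
          ≡⟨ insertAfter-++ʳ cs before (S ++ after) a∉before ⟩
        before ++ insertAfter a cs (S ++ after)
          ≡⟨ cong (λ z → before ++ insertAfter a cs (z ++ after)) S≡init∷ʳl ⟩
        before ++ insertAfter a cs ((init ++ [ a ]) ++ after)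
          ≡⟨ cong (λ z → before ++ insertAfter a cs z) (++-assoc init [ a ] after) ⟩
        before ++ insertAfter a cs (init ++ a ∷ after)
          ≡⟨ cong (before ++_) (insertAfter-++ʳ cs init (a ∷ after) a∉init) ⟩
        before ++ init ++ insertAfter a cs (a ∷ after)
          ≡⟨ cong (λ z → before ++ init ++ z) (insertAfter-here a cs after) ⟩
        before ++ init ++ a ∷ cs ++ after
          ≡⟨ cong (before ++_) (sym (++-assoc init [ a ] (cs ++ after))) ⟩
        before ++ (init ++ [ a ]) ++ cs ++ after
          ≡⟨ cong (λ z → before ++ z ++ cs ++ after) (sym S≡init∷ʳl) ⟩
        before ++ S ++ cs ++ after ∎ }
    where
    open ≡-Reasoning
    a∉init : a ∉ init
    a∉init a∈ = Unique-++⁻ init (subst Unique S≡init∷ʳl uniqueS) (a∈ , here refl)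

nth-++ : ∀ (A M : List Word) d → nth (A ++ M) (length A + d) ≡ nth M d
nth-++ []      M d = refl
nth-++ (x ∷ A) M d = nth-++ A M d

nth-++ˡ : ∀ (M B : List Word) {d} → d < length M → nth (M ++ B) d ≡ nth M d
nth-++ˡ (x ∷ M) B {zero}  _       = refl
nth-++ˡ (x ∷ M) B {suc d} (s≤s l) = nth-++ˡ M B l

nth⇒∈ : ∀ (L : List Word) {i x} → nth L i ≡ just x → x ∈ L
nth⇒∈ (y ∷ L) {zero}  refl = here refl
nth⇒∈ (y ∷ L) {suc i} eq   = there (nth⇒∈ L eq)

∈⇒nth : ∀ {L : List Word} {x} → x ∈ L → ∃ λ d → d < length L × nth L d ≡ just x
∈⇒nth (here refl) = 0 , z<s , refl
∈⇒nth (there x∈) with d , d< , eq ← ∈⇒nth x∈ = suc d , s≤s d< , eq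

nth-injective : ∀ (L : List Word) {i j x} → Unique L → nth L i ≡ just x → nth L j ≡ just x → i ≡ j
nth-injective (y ∷ L) {zero}  {zero}  _ _    _  = refl
nth-injective (y ∷ L) {zero}  {suc j} u refl eq = ⊥-elim (Unique[x∷xs]⇒x∉xs u (nth⇒∈ L eq))
nth-injective (y ∷ L) {suc i} {zero}  u eq refl = ⊥-elim (Unique[x∷xs]⇒x∉xs u (nth⇒∈ L eq))
nth-injective (y ∷ L) {suc i} {suc j} (_ AllPairs.∷ u) eq₁ eq₂ = cong suc (nth-injective L u eq₁ eq₂)

module BlockIndex {L f l S} (block : Block L f l S) where
  open Block block public

  length-S : length S ≡ suc (length init)
  length-S = trans (cong length S≡init∷ʳl) (trans (length-++ init) (+-comm (length init) 1))

  nth-inside : ∀ d → d < length S → nth L (length before + d) ≡ nth S d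
  nth-inside d d<S = begin
    nth L (length before + d)                      ≡⟨ cong (λ z → nth z (length before + d)) L≡ ⟩
    nth (before ++ S ++ after) (length before + d) ≡⟨ nth-++ before (S ++ after) d ⟩
    nth (S ++ after) d                             ≡⟨ nth-++ˡ S after d<S ⟩
    nth S d                                        ∎
    where open ≡-Reasoning

  first-index : nth L (length before) ≡ just f
  first-index = trans (cong (nth L) (sym (+-identityʳ _)))
    (trans (nth-inside 0 (subst (λ z → 0 < length z) (sym S≡f∷rest) z<s)) (cong (λ z → nth z 0) S≡f∷rest))

  last-index : nth L (length before + length init) ≡ just l
  last-index = trans (nth-inside (length init) (subst (length init <_) (sym length-S) ≤-refl))
    (trans (cong (λ z → nth z (length init)) S≡init∷ʳl)
      (trans (cong (nth (init ++ [ l ])) (sym (+-identityʳ _))) (nth-++ init [ l ] 0)))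

  ∈⇒index : ∀ {x} → x ∈ S → ∃ λ d → d < length S × nth L (length before + d) ≡ just x
  ∈⇒index x∈ with d , d<S , eq ← ∈⇒nth x∈ = d , d<S , trans (nth-inside d d<S) eq

  index⇒∈ : ∀ {i x} → nth L i ≡ just x → length before ≤ i → i < length before + length S → x ∈ S
  index⇒∈ {i} eq b≤i i<bS = nth⇒∈ S (trans (sym (nth-inside d d<S)) (trans (cong (nth L) i≡) eq))
    where
    d = i ∸ length before
    i≡ : length before + d ≡ i
    i≡ = m+[n∸m]≡n b≤i
    d<S : d < length S
    d<S = +-cancelˡ-< (length before) d (length S) (subst (_< length before + length S) (sym i≡) i<bS)

-- Cycles of key-words

Shape : Word → Set
Shape x = ∃ λ a → ∃ λ s → ∃ λ w → x ≡ replicate a 0 ++ suc s ∷ w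

zeros-or-Shape : ∀ x → AllZero x ⊎ Shape x
zeros-or-Shape []          = inj₁ []
zeros-or-Shape (suc s ∷ x) = inj₂ (0 , s , x , refl)
zeros-or-Shape (zero ∷ x) with zeros-or-Shape x
... | inj₁ zeros                = inj₁ (refl ∷ zeros)
... | inj₂ (a , s , w , x≡)     = inj₂ (suc a , s , w , cong (0 ∷_) x≡)

decomp-0ᵃσw : ∀ a s w → decomp (replicate a 0 ++ suc s ∷ w) ≡ dec a s w
decomp-0ᵃσw zero    s w = refl
decomp-0ᵃσw (suc a) s w rewrite decomp-0ᵃσw a s w = refl

module KeyCycle (a s : ℕ) (w : Word) where

  W : Word
  W = replicate a 0 ++ suc s ∷ w

  lastOfKey≡ : lastOfKey W ≡ suc s ∷ w ++ replicate a 0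
  lastOfKey≡ rewrite decomp-0ᵃσw a s w = refl

  anchorOfKey≡ : anchorOfKey W ≡ s ∷ w ++ replicate a 0
  anchorOfKey≡ rewrite decomp-0ᵃσw a s w = refl

  private
    u : Word
    u = replicate a 0 ++ [ suc s ]

    firstOfKey≡ : firstOfKey W ≡ rot1^ (length u) W
    firstOfKey≡ rewrite decomp-0ᵃσw a s w = begin
      w ++ replicate a 0 ++ [ suc s ]   ≡⟨ sym (rot1^-length-++ u w) ⟩
      rot1^ (length u) (u ++ w)          ≡⟨ cong (rot1^ (length u)) (++-assoc (replicate a 0) [ suc s ] w) ⟩
      rot1^ (length u) W                 ∎
      where open ≡-Reasoning

    W-nonempty : 1 ≤ length W
    W-nonempty = subst (1 ≤_) (sym (length-++ (replicate a 0)))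
      (≤-trans (s≤s z≤n) (m≤n+m (suc (length w)) (length (replicate a 0))))

    rot1-lastOfKey : rot1 (lastOfKey W) ≡ firstOfKey W
    rot1-lastOfKey rewrite decomp-0ᵃσw a s w = ++-assoc w (replicate a 0) [ suc s ]

  open Orbit W W-nonempty using (module From)
  open From (length u)

  cycleW : List Word
  cycleW = iterate rot1 (firstOfKey W) (period W)

  private
    cycleW≡orbit : cycleW ≡ orbit
    cycleW≡orbit = cong (λ y → iterate rot1 y (period W)) firstOfKey≡

  cycleW-head : ∃ λ S → cycleW ≡ firstOfKey W ∷ S
  cycleW-head with S , eq ← orbit-head = S , trans cycleW≡orbit (trans eq (cong (_∷ S) (sym firstOfKey≡)))

  cycleW-last : ∃ λ S → cycleW ≡ S ++ [ lastOfKey W ]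
  cycleW-last with S , eq ← orbit-last (trans rot1-lastOfKey firstOfKey≡) = S , trans cycleW≡orbit eq

  cycleW-unique : Unique cycleW
  cycleW-unique = subst Unique (sym cycleW≡orbit) orbit-unique

  ∈-cycleW⇒Conjugate : ∀ {x} → x ∈ cycleW → Conjugate x W
  ∈-cycleW⇒Conjugate x∈ = ∈-orbit⇒Conjugate (subst (_ ∈_) cycleW≡orbit x∈)

-- Zeroing non-zero letters

zeroFirst : Word → Word
zeroFirst []          = []
zeroFirst (zero ∷ xs) = zero ∷ zeroFirst xs
zeroFirst (suc _ ∷ xs) = zero ∷ xs

zeroFirst^ : ℕ → Word → Word
zeroFirst^ zero    x = x
zeroFirst^ (suc t) x = zeroFirst (zeroFirst^ t x)

nz-zeroFirst : ∀ x → nz (zeroFirst x) ≡ nz x ∸ 1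
nz-zeroFirst []           = refl
nz-zeroFirst (zero ∷ xs)  = nz-zeroFirst xs
nz-zeroFirst (suc _ ∷ xs) = refl

nz-zeroFirst^ : ∀ t x → nz (zeroFirst^ t x) ≡ nz x ∸ t
nz-zeroFirst^ zero    x = refl
nz-zeroFirst^ (suc t) x = begin
  nz (zeroFirst (zeroFirst^ t x)) ≡⟨ nz-zeroFirst (zeroFirst^ t x) ⟩
  nz (zeroFirst^ t x) ∸ 1         ≡⟨ cong (_∸ 1) (nz-zeroFirst^ t x) ⟩
  nz x ∸ t ∸ 1                    ≡⟨ ∸-+-assoc (nz x) t 1 ⟩
  nz x ∸ (t + 1)                  ≡⟨ cong (nz x ∸_) (+-comm t 1) ⟩
  nz x ∸ suc t                    ∎
  where open ≡-Reasoning

zeroFirst-0ᵃσw : ∀ a s w → zeroFirst (replicate a 0 ++ suc s ∷ w) ≡ replicate a 0 ++ 0 ∷ w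
zeroFirst-0ᵃσw zero    s w = refl
zeroFirst-0ᵃσw (suc a) s w = cong (0 ∷_) (zeroFirst-0ᵃσw a s w)

nz-0ᵃσw : ∀ a s w → 1 ≤ nz (replicate a 0 ++ suc s ∷ w)
nz-0ᵃσw zero    s w = s≤s z≤n
nz-0ᵃσw (suc a) s w = nz-0ᵃσw a s w

0ᵃσw-Conjugate : ∀ a s w → Conjugate (replicate a 0 ++ s ∷ w) (s ∷ w ++ replicate a 0)
0ᵃσw-Conjugate a s w = replicate a 0 , s ∷ w , refl , refl

zeroFirst-keys : ∀ a s w a′ s′ w′ → IsKeyWord (replicate a 0 ++ suc s ∷ w) →
  IsKeyWord (replicate a′ 0 ++ suc s′ ∷ w′) → w ++ replicate a 0 ≡ w′ ++ replicate a′ 0 →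
  zeroFirst (replicate a 0 ++ suc s ∷ w) ≡ zeroFirst (replicate a′ 0 ++ suc s′ ∷ w′)
zeroFirst-keys a s w a′ s′ w′ key key′ tails = begin
  zeroFirst (replicate a 0 ++ suc s ∷ w)     ≡⟨ zeroFirst-0ᵃσw a s w ⟩
  replicate a 0 ++ 0 ∷ w                     ≡⟨ IsKeyWord-conjugate (IsKeyWord-lower a w key z≤n)
                                                  (IsKeyWord-lower a′ w′ key′ z≤n) conj ⟩
  replicate a′ 0 ++ 0 ∷ w′                   ≡⟨ sym (zeroFirst-0ᵃσw a′ s′ w′) ⟩
  zeroFirst (replicate a′ 0 ++ suc s′ ∷ w′)  ∎
  where
  open ≡-Reasoning
  conj : Conjugate (replicate a 0 ++ 0 ∷ w) (replicate a′ 0 ++ 0 ∷ w′)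
  conj = Conjugate-trans (0ᵃσw-Conjugate a 0 w)
           (subst (λ z → Conjugate (0 ∷ z) _) (sym tails) (Conjugate-sym (0ᵃσw-Conjugate a′ 0 w′)))

-- The construction of D(n,k)

module Construction (n k : ℕ) where
  open Keys n k

  K : ℕ → Word
  K = key n k

  key-Shape : ∀ {m} → suc m < c n k → Shape (K (suc m))
  key-Shape {m} sm<c with zeros-or-Shape (K (suc m))
  ... | inj₂ shape = shape
  ... | inj₁ zeros = ⊥-elim (1+n≢0 (key-injective sm<c 0<c (begin
      K (suc m)                          ≡⟨ AllZero⇒replicate zeros ⟩
      replicate (length (K (suc m))) 0   ≡⟨ cong (λ t → replicate t 0) (key-length sm<c) ⟩
      replicate n 0                      ≡⟨ sym (key₀ n k 0<c) ⟩
      K 0                                ∎)))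
    where
    open ≡-Reasoning
    0<c : 0 < c n k
    0<c = ≤-trans (s≤s z≤n) sm<c

  C : ℕ → List Word
  C = cycle n k

  cycle-head : ∀ {m} → m < c n k → ∃ λ S → C m ≡ first n k m ∷ S
  cycle-head {zero}  _    = [] , refl
  cycle-head {suc m} sm<c with a , s , w , eq ← key-Shape sm<c =
    subst (λ W → ∃ λ S → iterate rot1 (firstOfKey W) (period W) ≡ firstOfKey W ∷ S) (sym eq)
      (KeyCycle.cycleW-head a s w)

  cycle-last : ∀ {m} → m < c n k → ∃ λ S → C m ≡ S ++ [ last n k m ]
  cycle-last {zero}  _    = [] , refl
  cycle-last {suc m} sm<c with a , s , w , eq ← key-Shape sm<c =
    subst (λ W → ∃ λ S → iterate rot1 (firstOfKey W) (period W) ≡ S ++ [ lastOfKey W ]) (sym eq)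
      (KeyCycle.cycleW-last a s w)

  cycle-unique : ∀ {m} → m < c n k → Unique (C m)
  cycle-unique {zero}  _    = [] AllPairs.∷ AllPairs.[]
  cycle-unique {suc m} sm<c with a , s , w , eq ← key-Shape sm<c =
    subst (λ W → Unique (iterate rot1 (firstOfKey W) (period W))) (sym eq) (KeyCycle.cycleW-unique a s w)

  ∈-cycle⇒Conjugate : ∀ {m x} → m < c n k → x ∈ C m → Conjugate x (K m)
  ∈-cycle⇒Conjugate {zero} 0<c (here refl) = subst (Conjugate _) (sym (key₀ n k 0<c)) (Conjugate-refl _)
  ∈-cycle⇒Conjugate {suc m} {x} sm<c x∈ with a , s , w , eq ← key-Shape sm<c =
    subst (λ W → x ∈ iterate rot1 (firstOfKey W) (period W) → Conjugate x W) (sym eq)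
      (KeyCycle.∈-cycleW⇒Conjugate a s w) x∈

  first∈cycle : ∀ {m} → m < c n k → first n k m ∈ C m
  first∈cycle {m} m<c with S , eq ← cycle-head m<c = subst (first n k m ∈_) (sym eq) (here refl)

  last∈cycle : ∀ {m} → m < c n k → last n k m ∈ C m
  last∈cycle {m} m<c with S , eq ← cycle-last m<c = subst (last n k m ∈_) (sym eq) (∈-++⁺ʳ S (here refl))

  cycles-disjoint : ∀ {p q x} → p < c n k → q < c n k → x ∈ C p → x ∈ C q → p ≡ q
  cycles-disjoint p<c q<c x∈p x∈q = key-injective p<c q<c
    (IsKeyWord-conjugate (key-IsKeyWord p<c) (key-IsKeyWord q<c)
      (Conjugate-trans (Conjugate-sym (∈-cycle⇒Conjugate p<c x∈p)) (∈-cycle⇒Conjugate q<c x∈q)))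

  D[_] : ℕ → List Word
  D[ j ] = Dm n k j

  anchor : ℕ → Word
  anchor m = anchorOfKey (K m)

  Inserted : ℕ → Set
  Inserted zero    = ⊤
  Inserted (suc m) = anchor (suc m) ∈ D[ m ]

  -- C q lies inside the block of D grown from C m: it was inserted after a word of a cycle
  -- nested in C m, and not after the last word of C m itself.
  data Nested (m : ℕ) : ℕ → Set where
    nested-refl : Nested m m
    nested-step : ∀ {p q} → Nested m p → suc q < c n k → p ≤ q → anchor (suc q) ∈ D[ q ] →
                  anchor (suc q) ∈ C p → p ≢ m ⊎ anchor (suc q) ≢ last n k m → Nested m (suc q)

  Nested-≤ : ∀ {m q} → Nested m q → m ≤ q
  Nested-≤ nested-refl                   = ≤-refl
  Nested-≤ (nested-step t _ p≤q _ _ _)   = m≤n⇒m≤1+n (≤-trans (Nested-≤ t) p≤q)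

  Nested-< : ∀ {m q} → Nested m q → q ≢ m → m < q
  Nested-< t q≢m = ≤∧≢⇒< (Nested-≤ t) (q≢m ∘ sym)

  Nested-<c : ∀ {m q} → m < c n k → Nested m q → q < c n k
  Nested-<c m<c nested-refl                = m<c
  Nested-<c _   (nested-step _ q<c _ _ _ _) = q<c

  Nested-Inserted : ∀ {m q} → Inserted m → Nested m q → Inserted q
  Nested-Inserted ins nested-refl                  = ins
  Nested-Inserted _   (nested-step _ _ _ a∈D _ _)  = a∈D

  record Segment (j m : ℕ) : Set where
    field
      S     : List Word
      block : Block D[ j ] (first n k m) (last n k m) S
      ∈S⁻   : ∀ {x} → x ∈ S → ∃ λ q → q ≤ j × Nested m q × x ∈ C q
      ∈S⁺   : ∀ {q x} → q ≤ j → Nested m q → x ∈ C q → x ∈ S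

  record Invariant (j : ℕ) : Set where
    field
      D-unique : Unique D[ j ]
      ∈D⁻      : ∀ {x} → x ∈ D[ j ] → ∃ λ q → q ≤ j × Inserted q × x ∈ C q
      segment  : ∀ {m} → m ≤ j → Inserted m → Segment j m

  invariant₀ : Invariant 0
  invariant₀ = record
    { D-unique = [] AllPairs.∷ AllPairs.[]
    ; ∈D⁻      = λ { (here refl) → 0 , ≤-refl , tt , here refl }
    ; segment  = λ { z≤n _ → record
        { S = [ replicate n 0 ]
        ; block = record { before = [] ; after = [] ; rest = [] ; init = []
                         ; L≡ = refl ; S≡f∷rest = refl ; S≡init∷ʳl = refl }
        ; ∈S⁻ = λ { (here refl) → 0 , ≤-refl , nested-refl , here refl }
        ; ∈S⁺ = λ { z≤n nested-refl x∈ → x∈ } } }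
    }

  ≤-suc-cases : ∀ {q j} → q ≤ suc j → q ≤ j ⊎ q ≡ suc j
  ≤-suc-cases q≤sj with m≤n⇒m<n∨m≡n q≤sj
  ... | inj₁ q<sj = inj₁ (s≤s⁻¹ q<sj)
  ... | inj₂ q≡sj = inj₂ q≡sj

  module Step (j : ℕ) (sj<c : suc j < c n k) (I : Invariant j) where
    open Invariant I

    a : Word
    a = anchor (suc j)

    cs : List Word
    cs = C (suc j)

    bounded : ∀ {q} → q ≤ j → q < c n k
    bounded q≤j = ≤-<-trans q≤j (<-trans (n<1+n j) sj<c)

    weaken : ∀ {P : ℕ → Set} → (∃ λ q → q ≤ j × P q) → ∃ λ q → q ≤ suc j × P q
    weaken (q , q≤j , Pq) = q , m≤n⇒m≤1+n q≤j , Pq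

    older∉cs : ∀ {q x} → q ≤ j → x ∈ C q → x ∉ cs
    older∉cs q≤j x∈q x∈cs = <-irrefl (cycles-disjoint (bounded q≤j) sj<c x∈q x∈cs) (s≤s q≤j)

    Nested-step-anchor : ∀ {m} → m ≤ j → Nested m (suc j) →
      ∃ λ p → p ≤ j × Nested m p × a ∈ C p × (p ≢ m ⊎ a ≢ last n k m)
    Nested-step-anchor m≤j nested-refl = ⊥-elim (<-irrefl refl m≤j)
    Nested-step-anchor m≤j (nested-step t _ p≤j _ a∈p cond) = _ , p≤j , t , a∈p , cond

    Nested-anchor∈D : ∀ {m} → m ≤ j → Nested m (suc j) → a ∈ D[ j ]
    Nested-anchor∈D m≤j nested-refl                 = ⊥-elim (<-irrefl refl m≤j)
    Nested-anchor∈D m≤j (nested-step _ _ _ a∈D _ _) = a∈D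

    Nested-step-inside : ∀ {m} → m ≤ j → (seg : Segment j m) → Nested m (suc j) →
      a ∈ Segment.S seg × a ≢ last n k m
    Nested-step-inside {m} m≤j seg t with p , p≤j , t′ , a∈p , cond ← Nested-step-anchor m≤j t =
      Segment.∈S⁺ seg p≤j t′ a∈p , a≢l cond
      where
      a≢l : p ≢ m ⊎ a ≢ last n k m → a ≢ last n k m
      a≢l (inj₂ a≢l′) a≡l = a≢l′ a≡l
      a≢l (inj₁ p≢m)  a≡l =
        p≢m (cycles-disjoint (bounded p≤j) (bounded m≤j) a∈p (subst (_∈ C m) (sym a≡l) (last∈cycle (bounded m≤j))))

    module Absent (a∉D : a ∉ D[ j ]) where

      D-unchanged : D[ suc j ] ≡ D[ j ]
      D-unchanged = insertAfter-∉ cs D[ j ] a∉D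

      segment′ : ∀ {m} → m ≤ j → Segment j m → Segment (suc j) m
      segment′ m≤j seg = record
        { S = S
        ; block = subst (λ L → Block L _ _ S) (sym D-unchanged) block
        ; ∈S⁻ = λ x∈ → weaken (∈S⁻ x∈)
        ; ∈S⁺ = ∈S⁺′ }
        where
        open Segment seg
        ∈S⁺′ : ∀ {q x} → q ≤ suc j → Nested _ q → x ∈ C q → x ∈ S
        ∈S⁺′ q≤sj t x∈ with ≤-suc-cases q≤sj
        ... | inj₁ q≤j  = ∈S⁺ q≤j t x∈
        ... | inj₂ refl = ⊥-elim (a∉D (Nested-anchor∈D m≤j t))

      invariant′ : Invariant (suc j)
      invariant′ = record
        { D-unique = subst Unique (sym D-unchanged) D-unique
        ; ∈D⁻      = λ x∈ → weaken (∈D⁻ (subst (_ ∈_) D-unchanged x∈))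
        ; segment  = segment″ }
        where
        segment″ : ∀ {m} → m ≤ suc j → Inserted m → Segment (suc j) m
        segment″ m≤sj ins with ≤-suc-cases m≤sj
        ... | inj₁ m≤j  = segment′ m≤j (segment m≤j ins)
        ... | inj₂ refl = ⊥-elim (a∉D ins)

    module Present (a∈D : a ∈ D[ j ]) where

      p : ℕ
      p = proj₁ (∈D⁻ a∈D)

      p≤j : p ≤ j
      p≤j = proj₁ (proj₂ (∈D⁻ a∈D))

      a∈p : a ∈ C p
      a∈p = proj₂ (proj₂ (proj₂ (∈D⁻ a∈D)))

      D′-unique : Unique D[ suc j ]
      D′-unique = insertAfter-unique cs D[ j ] D-unique (cycle-unique sj<c)
        (λ (x∈D , x∈cs) → let (q , q≤j , _ , x∈q) = ∈D⁻ x∈D in older∉cs q≤j x∈q x∈cs)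

      ∈D′⁻ : ∀ {x} → x ∈ D[ suc j ] → ∃ λ q → q ≤ suc j × Inserted q × x ∈ C q
      ∈D′⁻ x∈ with ∈-insertAfter⁻ cs D[ j ] x∈
      ... | inj₁ x∈D  = weaken (∈D⁻ x∈D)
      ... | inj₂ x∈cs = suc j , ≤-refl , a∈D , x∈cs

      new-segment : Segment (suc j) (suc j)
      new-segment = record
        { S = cs
        ; block = record
          { before = X ++ [ a ] ; after = Y
          ; rest = proj₁ (cycle-head sj<c) ; init = proj₁ (cycle-last sj<c)
          ; L≡ = D′≡ ; S≡f∷rest = proj₂ (cycle-head sj<c) ; S≡init∷ʳl = proj₂ (cycle-last sj<c) }
        ; ∈S⁻ = λ x∈ → suc j , ≤-refl , nested-refl , x∈
        ; ∈S⁺ = λ q≤sj t x∈ → subst (λ q → _ ∈ C q) (≤-antisym q≤sj (Nested-≤ t)) x∈ }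
        where
        X Y : List Word
        X = proj₁ (insertAfter-split cs D[ j ] a∈D)
        Y = proj₁ (proj₂ (insertAfter-split cs D[ j ] a∈D))
        D′≡ : D[ suc j ] ≡ (X ++ [ a ]) ++ cs ++ Y
        D′≡ = proj₂ (proj₂ (insertAfter-split cs D[ j ] a∈D))

      segment-inside : ∀ {m} → (seg : Segment j m) → a ∈ Segment.S seg → a ≢ last n k m → Segment (suc j) m
      segment-inside {m} seg a∈S a≢l = record
        { S = insertAfter a cs S
        ; block = Block-insertAfter-inside D-unique block cs a∈S a≢l
        ; ∈S⁻ = ∈S′⁻
        ; ∈S⁺ = ∈S′⁺ }
        where
        open Segment seg
        ∈S′⁻ : ∀ {x} → x ∈ insertAfter a cs S → ∃ λ q → q ≤ suc j × Nested m q × x ∈ C q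
        ∈S′⁻ x∈ with ∈-insertAfter⁻ cs S x∈
        ... | inj₁ x∈S  = weaken (∈S⁻ x∈S)
        ... | inj₂ x∈cs with q , q≤j , t , a∈q ← ∈S⁻ a∈S =
          suc j , ≤-refl , nested-step t sj<c q≤j a∈D a∈q (inj₂ a≢l) , x∈cs
        ∈S′⁺ : ∀ {q x} → q ≤ suc j → Nested m q → x ∈ C q → x ∈ insertAfter a cs S
        ∈S′⁺ q≤sj t x∈ with ≤-suc-cases q≤sj
        ... | inj₁ q≤j  = ∈-insertAfter⁺ˡ cs S (∈S⁺ q≤j t x∈)
        ... | inj₂ refl = ∈-insertAfter⁺ʳ cs S a∈S x∈

      segment-outside : ∀ {m} → m ≤ j → (seg : Segment j m) → ¬ (a ∈ Segment.S seg × a ≢ last n k m) →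
        Segment (suc j) m
      segment-outside {m} m≤j seg outside = record
        { S = S
        ; block = Block-insertAfter-outside D-unique block cs outside
        ; ∈S⁻ = λ x∈ → weaken (∈S⁻ x∈)
        ; ∈S⁺ = ∈S′⁺ }
        where
        open Segment seg
        ∈S′⁺ : ∀ {q x} → q ≤ suc j → Nested m q → x ∈ C q → x ∈ S
        ∈S′⁺ q≤sj t x∈ with ≤-suc-cases q≤sj
        ... | inj₁ q≤j  = ∈S⁺ q≤j t x∈
        ... | inj₂ refl = ⊥-elim (outside (Nested-step-inside m≤j seg t))

      old-segment : ∀ {m} → m ≤ j → Segment j m → Segment (suc j) m
      old-segment {m} m≤j seg with (a ∈? Segment.S seg) ×-dec ¬? (≡-dec _≟_ a (last n k m))
      ... | yes (a∈S , a≢l) = segment-inside seg a∈S a≢l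
      ... | no outside      = segment-outside m≤j seg outside

      invariant′ : Invariant (suc j)
      invariant′ = record
        { D-unique = D′-unique
        ; ∈D⁻      = ∈D′⁻
        ; segment  = segment′ }
        where
        segment′ : ∀ {m} → m ≤ suc j → Inserted m → Segment (suc j) m
        segment′ m≤sj ins with ≤-suc-cases m≤sj
        ... | inj₁ m≤j  = old-segment m≤j (segment m≤j ins)
        ... | inj₂ refl = new-segment

    invariant-step : Invariant (suc j)
    invariant-step with a ∈? D[ j ]
    ... | yes a∈D = Present.invariant′ a∈D
    ... | no  a∉D = Absent.invariant′ a∉D

  invariant : ∀ j → j < c n k → Invariant j
  invariant zero    _    = invariant₀
  invariant (suc j) sj<c = Step.invariant-step j sj<c (invariant j (<-trans (n<1+n j) sj<c))

  Shape-not-AllZero : ∀ a s w → ¬ AllZero (replicate a 0 ++ suc s ∷ w)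
  Shape-not-AllZero a s w zeros with All.++⁻ʳ (replicate a 0) zeros
  ... | () ∷ _

  last-of-Shape : ∀ {m a s w} → m < c n k → K m ≡ replicate a 0 ++ suc s ∷ w →
    last n k m ≡ suc s ∷ w ++ replicate a 0
  last-of-Shape {zero} {a} {s} {w} 0<c K₀≡ =
    ⊥-elim (Shape-not-AllZero a s w (subst AllZero (trans (sym (key₀ n k 0<c)) K₀≡) (All.replicate⁺ n refl)))
  last-of-Shape {suc m} {a} {s} {w} _ Km≡ = trans (cong lastOfKey Km≡) (KeyCycle.lastOfKey≡ a s w)

  anchor-of-Shape : ∀ {m a s w} → K m ≡ replicate a 0 ++ suc s ∷ w → anchor m ≡ s ∷ w ++ replicate a 0
  anchor-of-Shape {a = a} {s} {w} Km≡ = trans (cong anchorOfKey Km≡) (KeyCycle.anchorOfKey≡ a s w)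

  key-of-anchor-cycle : ∀ {p r a s w} → p < c n k → r < c n k → K r ≡ replicate a 0 ++ suc s ∷ w →
    anchor r ∈ C p → K p ≡ replicate a 0 ++ s ∷ w
  key-of-anchor-cycle {p} {r} {a} {s} {w} p<c r<c Kr≡ a∈p =
    IsKeyWord-conjugate (key-IsKeyWord p<c) (IsKeyWord-lower a w (subst IsKeyWord Kr≡ (key-IsKeyWord r<c)) (n≤1+n s))
      (Conjugate-trans (Conjugate-sym (∈-cycle⇒Conjugate p<c a∈p))
        (subst (λ z → Conjugate z (replicate a 0 ++ s ∷ w)) (sym (anchor-of-Shape Kr≡))
          (Conjugate-sym (0ᵃσw-Conjugate a s w))))

  anchor-in-root : ∀ {q m} → m < c n k → suc q < c n k → anchor (suc q) ∈ C m →
    anchor (suc q) ≢ last n k m → K m ≡ zeroFirst (K (suc q))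
  anchor-in-root m<c r<c a∈m a≢l with key-Shape r<c
  ... | a , zero , w , Kr≡ =
    trans (key-of-anchor-cycle m<c r<c Kr≡ a∈m) (sym (trans (cong zeroFirst Kr≡) (zeroFirst-0ᵃσw a 0 w)))
  ... | a , suc s , w , Kr≡ =
    ⊥-elim (a≢l (trans (anchor-of-Shape Kr≡) (sym (last-of-Shape m<c (key-of-anchor-cycle m<c r<c Kr≡ a∈m)))))

  anchor-at-last : ∀ {p q} → 0 < p → p < c n k → suc q < c n k → anchor (suc q) ≡ last n k p →
    zeroFirst (K p) ≡ zeroFirst (K (suc q))
  anchor-at-last {suc _} _ p<c r<c a≡l with key-Shape p<c | key-Shape r<c
  ... | a′ , s′ , w′ , Kp≡ | a , s , w , Kr≡ = begin
    zeroFirst (K _)                             ≡⟨ cong zeroFirst Kp≡ ⟩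
    zeroFirst (replicate a′ 0 ++ suc s′ ∷ w′)   ≡⟨ zeroFirst-keys a′ s′ w′ a s w (keyword Kp≡ p<c) (keyword Kr≡ r<c)
                                                     (∷-injectiveʳ tails) ⟩
    zeroFirst (replicate a 0 ++ suc s ∷ w)      ≡⟨ cong zeroFirst (sym Kr≡) ⟩
    zeroFirst (K _)                             ∎
    where
    open ≡-Reasoning
    keyword : ∀ {m W} → K m ≡ W → m < c n k → IsKeyWord W
    keyword Km≡ m<c = subst IsKeyWord Km≡ (key-IsKeyWord m<c)
    tails : suc s′ ∷ w′ ++ replicate a′ 0 ≡ s ∷ w ++ replicate a 0
    tails = trans (sym (last-of-Shape p<c Kp≡)) (trans (sym a≡l) (anchor-of-Shape Kr≡))

  <⇒≤∸1 : ∀ {q m} → q < m → q ≤ m ∸ 1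
  <⇒≤∸1 (s≤s q≤m) = q≤m

  ∸1< : ∀ {m} → 0 < m → m ∸ 1 < m
  ∸1< (s≤s _) = ≤-refl

  module Embeddings (0<c : 0 < c n k) where
    open Invariant (invariant (c n k ∸ 1) (∸1< 0<c))

    segment-of : ∀ {m} → m < c n k → Inserted m → Segment (c n k ∸ 1) m
    segment-of m<c = segment (<⇒≤∸1 m<c)

    same-index : ∀ {i x y} → nth (D n k) i ≡ just x → nth (D n k) i ≡ just y → x ≡ y
    same-index eq₁ eq₂ = just-injective (trans (sym eq₁) eq₂)

    index-injective : ∀ {i j x} → nth (D n k) i ≡ just x → nth (D n k) j ≡ just x → i ≡ j
    index-injective = nth-injective (D n k) D-unique

    first-Inserted : ∀ {m} → m < c n k → first n k m ∈ D n k → Inserted m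
    first-Inserted m<c f∈D with q , q≤ , ins , f∈q ← ∈D⁻ f∈D =
      subst Inserted (cycles-disjoint (≤-<-trans q≤ (∸1< 0<c)) m<c f∈q (first∈cycle m<c)) ins

    first≤last : ∀ {r} → r < c n k → Inserted r → BeforeEq n k (first n k r) (last n k r)
    first≤last r<c ins with Segment.block (segment-of r<c ins)
    ... | blk with BlockIndex.init blk in init≡
    ...   | [] = inj₁ (∷-injectiveˡ (trans (sym (BlockIndex.S≡f∷rest blk))
                        (trans (BlockIndex.S≡init∷ʳl blk) (cong (_++ _) init≡))))
    ...   | _ ∷ _ = inj₂ (_ , _ , subst (λ z → length (BlockIndex.before blk) < length (BlockIndex.before blk) + length z)
                                   (sym init≡) (m<m+n _ z<s)
                         , BlockIndex.first-index blk , BlockIndex.last-index blk)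

    Embedded⇒Nested : ∀ {r m} → r < c n k → m < c n k → Embedded n k r m →
      Nested m r × r ≢ m × Inserted m
    Embedded⇒Nested {r} {m} r<c m<c ((i₀ , j₀ , i₀<j₀ , fm , fr) , fr≤lr , (i₂ , j₂ , i₂<j₂ , lr , lm)) =
      nested , r≢m , ins
      where
      ins : Inserted m
      ins = first-Inserted m<c (nth⇒∈ (D n k) fm)
      seg = segment-of m<c ins
      open Segment seg
      open BlockIndex block
      r≢m : r ≢ m
      r≢m refl = <-irrefl (index-injective fm fr) i₀<j₀
      j₀≤i₂ : j₀ ≤ i₂
      j₀≤i₂ = first≤last-index fr≤lr
        where
        first≤last-index : BeforeEq n k (first n k r) (last n k r) → j₀ ≤ i₂
        first≤last-index (inj₁ fr≡lr) =
          ≤-reflexive (index-injective fr (subst (λ z → nth (D n k) i₂ ≡ just z) (sym fr≡lr) lr))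
        first≤last-index (inj₂ (i₁ , j₁ , i₁<j₁ , fr′ , lr′)) =
          subst₂ _≤_ (index-injective fr′ fr) (index-injective lr′ lr) (<⇒≤ i₁<j₁)
      fr∈S : first n k r ∈ S
      fr∈S = index⇒∈ fr (subst (_≤ j₀) (index-injective fm first-index) (<⇒≤ i₀<j₀)) (begin-strict
        j₀                                     ≤⟨ j₀≤i₂ ⟩
        i₂                                     <⟨ i₂<j₂ ⟩
        j₂                                     ≡⟨ index-injective lm last-index ⟩
        length before + length init            <⟨ +-monoʳ-< (length before) (n<1+n (length init)) ⟩
        length before + suc (length init)      ≡⟨ cong (length before +_) (sym length-S) ⟩
        length before + length S               ∎)
        where open ≤-Reasoning
      nested : Nested m r
      nested = let (q , _ , t , fr∈q) = ∈S⁻ fr∈S in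
        subst (Nested m) (cycles-disjoint (Nested-<c m<c t) r<c fr∈q (first∈cycle r<c)) t

    Nested⇒Embedded : ∀ {r m} → m < c n k → Inserted m → Nested m r → r ≢ m → Embedded n k r m
    Nested⇒Embedded {r} {m} m<c ins t r≢m =
      (length before , length before + d₁ , fm<fr , first-index , fr) ,
      first≤last r<c (Nested-Inserted ins t) ,
      (length before + d₂ , length before + length init , lr<lm , lr , last-index)
      where
      r<c = Nested-<c m<c t
      seg = segment-of m<c ins
      open Segment seg
      open BlockIndex block
      other-cycle : ∀ {x} → x ∈ C r → x ∈ C m → ⊥
      other-cycle x∈r x∈m = r≢m (cycles-disjoint r<c m<c x∈r x∈m)
      fr-index = ∈⇒index (∈S⁺ (<⇒≤∸1 r<c) t (first∈cycle r<c))
      lr-index = ∈⇒index (∈S⁺ (<⇒≤∸1 r<c) t (last∈cycle r<c))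
      d₁ = proj₁ fr-index
      d₂ = proj₁ lr-index
      fr : nth (D n k) (length before + d₁) ≡ just (first n k r)
      fr = proj₂ (proj₂ fr-index)
      lr : nth (D n k) (length before + d₂) ≡ just (last n k r)
      lr = proj₂ (proj₂ lr-index)
      fm<fr : length before < length before + d₁
      fm<fr with m≤n⇒m<n∨m≡n (m≤m+n (length before) d₁)
      ... | inj₁ fm<fr′ = fm<fr′
      ... | inj₂ fm≡fr  = ⊥-elim (other-cycle (first∈cycle r<c)
            (subst (_∈ C m) (same-index first-index (subst (λ i → nth (D n k) i ≡ _) (sym fm≡fr) fr)) (first∈cycle m<c)))
      lr<lm : length before + d₂ < length before + length init
      lr<lm with m≤n⇒m<n∨m≡n (s≤s⁻¹ (subst (d₂ <_) length-S (proj₁ (proj₂ lr-index))))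
      ... | inj₁ d₂<init = +-monoʳ-< (length before) d₂<init
      ... | inj₂ d₂≡init = ⊥-elim (other-cycle (last∈cycle r<c)
            (subst (_∈ C m) (same-index last-index (subst (λ d → nth (D n k) (length before + d) ≡ _) d₂≡init lr))
              (last∈cycle m<c)))

    immediate-key : ∀ {r m} → m < c n k → Inserted m → Nested m r → r ≢ m → ImmEmbedded n k r m →
      K m ≡ zeroFirst (K r)
    immediate-key _ _ nested-refl r≢m _ = ⊥-elim (r≢m refl)
    immediate-key {suc q} {m} m<c ins (nested-step {p} t r<c p≤q a∈D a∈p cond) _ (_ , nothing-between)
      with p ≟ m
    ... | yes refl =
      anchor-in-root m<c r<c a∈p (λ a≡l → Sum.[ (λ m≢m → m≢m refl) , (λ a≢l → a≢l a≡l) ] cond)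
    ... | no p≢m with ≡-dec _≟_ (anchor (suc q)) (last n k p)
    ...   | no a≢l = ⊥-elim (nothing-between (p , p<c ,
              Nested⇒Embedded p<c (Nested-Inserted ins t) (nested-step nested-refl r<c p≤q a∈D a∈p (inj₂ a≢l)) r≢p ,
              Nested⇒Embedded m<c ins t p≢m))
      where
      p<c = Nested-<c m<c t
      r≢p : suc q ≢ p
      r≢p r≡p = <-irrefl (sym r≡p) (s≤s p≤q)
    ...   | yes a≡l = trans (immediate-key m<c ins t p≢m p-immediate)
                          (anchor-at-last (≤-<-trans z≤n (Nested-< t p≢m)) (Nested-<c m<c t) r<c a≡l)
      where
      p-immediate : ImmEmbedded n k p m
      p-immediate = Nested⇒Embedded m<c ins t p≢m , λ (l , l<c , p-in-l , l-in-m) →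
        let (t′ , p≢l , ins′) = Embedded⇒Nested (Nested-<c m<c t) l<c p-in-l in
        nothing-between (l , l<c ,
          Nested⇒Embedded l<c ins′ (nested-step t′ r<c p≤q a∈D a∈p (inj₁ p≢l))
            (λ r≡l → <-irrefl (sym r≡l) (s≤s (≤-trans (Nested-≤ t′) p≤q))) , l-in-m)

    immediate⇒key : ∀ {r m} → r < c n k → m < c n k → ImmEmbedded n k r m →
      K m ≡ zeroFirst (K r) × 1 ≤ nz (K r)
    immediate⇒key {r} r<c m<c imm@(r-in-m , _) =
      let (t , r≢m , ins) = Embedded⇒Nested r<c m<c r-in-m in
      immediate-key m<c ins t r≢m imm , nz-K (≤-<-trans z≤n (Nested-< t r≢m))
      where
      nz-K : 0 < r → 1 ≤ nz (K r)
      nz-K (s≤s _) = let (a , s , w , Kr≡) = key-Shape r<c in subst (λ z → 1 ≤ nz z) (sym Kr≡) (nz-0ᵃσw a s w)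

    TEmbedded⇒key : ∀ {t r m} → r < c n k → m < c n k → TEmbedded n k t r m →
      K m ≡ zeroFirst^ t (K r) × t ≤ nz (K r)
    TEmbedded⇒key r<c m<c (one imm) = immediate⇒key r<c m<c imm
    TEmbedded⇒key {suc t} {r} r<c m<c (step l<c te imm) =
      trans Km≡ (cong zeroFirst Kl≡) , m∸n≢0⇒n<m (λ nz∸t≡0 → <-irrefl (sym nz∸t≡0) 1≤nz∸t)
      where
      Kl≡ = proj₁ (TEmbedded⇒key r<c l<c te)
      Km≡ = proj₁ (immediate⇒key l<c m<c imm)
      1≤nz∸t : 1 ≤ nz (K r) ∸ t
      1≤nz∸t = subst (1 ≤_) (trans (cong nz Kl≡) (nz-zeroFirst^ t (K r))) (proj₂ (immediate⇒key l<c m<c imm))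

zeroFirst^-0∷ : ∀ t xs → zeroFirst^ t (0 ∷ xs) ≡ 0 ∷ zeroFirst^ t xs
zeroFirst^-0∷ zero    xs = refl
zeroFirst^-0∷ (suc t) xs = cong zeroFirst (zeroFirst^-0∷ t xs)

zeroFirst^-suc∷ : ∀ t s xs → zeroFirst^ (suc t) (suc s ∷ xs) ≡ 0 ∷ zeroFirst^ t xs
zeroFirst^-suc∷ zero    s xs = refl
zeroFirst^-suc∷ (suc t) s xs = cong zeroFirst (zeroFirst^-suc∷ t s xs)

zeroFirst^-ShortestNZPrefix : ∀ t x → 1 ≤ t → t ≤ nz x →
  ∃[ u ] ∃[ v ] (ShortestNZPrefix t x u v × zeroFirst^ t x ≡ replicate (length u) 0 ++ v)
zeroFirst^-ShortestNZPrefix t [] 1≤t t≤0 = ⊥-elim (<-irrefl refl (≤-trans 1≤t t≤0))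
zeroFirst^-ShortestNZPrefix t (zero ∷ xs) 1≤t t≤nz
  with u , v , (xs≡uv , nz-u , shortest) , zeroed ← zeroFirst^-ShortestNZPrefix t xs 1≤t t≤nz =
  0 ∷ u , v , (cong (0 ∷_) xs≡uv , nz-u , shortest′) , trans (zeroFirst^-0∷ t xs) (cong (0 ∷_) zeroed)
  where
  shortest′ : ∀ j → nz (take j (zero ∷ xs)) ≡ t → length (0 ∷ u) ≤ j
  shortest′ zero    0≡t = ⊥-elim (<-irrefl 0≡t 1≤t)
  shortest′ (suc j) eq  = s≤s (shortest j eq)
zeroFirst^-ShortestNZPrefix (suc zero) (suc s ∷ xs) _ _ = suc s ∷ [] , xs , (refl , refl , shortest) , refl
  where
  shortest : ∀ j → nz (take j (suc s ∷ xs)) ≡ 1 → 1 ≤ j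
  shortest zero    ()
  shortest (suc j) _ = s≤s z≤n
zeroFirst^-ShortestNZPrefix (suc (suc t)) (suc s ∷ xs) _ (s≤s t≤nz)
  with u , v , (xs≡uv , nz-u , shortest) , zeroed ← zeroFirst^-ShortestNZPrefix (suc t) xs (s≤s z≤n) t≤nz =
  suc s ∷ u , v , (cong (suc s ∷_) xs≡uv , cong suc nz-u , shortest′) ,
  trans (zeroFirst^-suc∷ (suc t) s xs) (cong (0 ∷_) zeroed)
  where
  shortest′ : ∀ j → nz (take j (suc s ∷ xs)) ≡ suc (suc t) → length (suc s ∷ u) ≤ j
  shortest′ zero    ()
  shortest′ (suc j) eq = s≤s (shortest j (suc-injective eq))

corollary3 : (n k t r m : ℕ) → 1 ≤ n → 1 ≤ t → r < c n k → m < c n k →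
    TEmbedded n k t r m →
    ∃[ u ] ∃[ v ] (ShortestNZPrefix t (key n k r) u v ×
      key n k m ≡ replicate (length u) 0 ++ v)
corollary3 n k t r m _ 1≤t r<c m<c te
  with Km≡ , t≤nz ← Construction.Embeddings.TEmbedded⇒key n k (≤-<-trans z≤n r<c) r<c m<c te
  with u , v , shortest , zeroed ← zeroFirst^-ShortestNZPrefix t (key n k r) 1≤t t≤nz =
  u , v , shortest , trans Km≡ zeroed
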